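{- Let $G$ be a triangle-free bad graph. Then $\overline{L(G)}$ is an equistable graph without a strong clique. In particular, $\overline{L(G)}$ is not a general partition graph.
   Context: Graphs are finite and simple. A chord of a cycle $C$ is an edge joining two non-consecutive vertices of $C$. Given an odd cycle $C$ and disjoint edges $e,e'\in E(C)$, $C-\{e,e'\}$ consists of two paths, exactly one of which, $P_0$, has even length; for $v\in V(P_0)$, $d_{P_0}(v,e)$ (resp. $d_{P_0}(v,e')$) is the distance along $P_0$ from $v$ to the end of $P_0$ that is an endpoint of $e$ (resp. $e'$). An $(e,e')$-non-crossing even chord is a chord with both endpoints on $P_0$ at even distance on $P_0$; an $(e,e')$-crossing odd chord is a chord with exactly one endpoint $v$ on $P_0$ and $d_{P_0}(v,e)\equiv d_{P_0}(v,e')\equiv 1\pmod 2$. A graph $G$ of odd order $n$ is bad if it has a Hamiltonian cycle $C_n$ such that for all disjoint $e,e'\in E(C_n)$, $G$ contains an $(e,e')$-non-crossing even chord or an $(e,e')$-crossing odd chord of $C_n$. $L(G)$ is the line graph and $\overline{H}$ the complement. A graph $H$ is equistable if there is $\varphi:V(H)\to\mathbb{R}_{>0}$ such that $S\subseteq V(H)$ is a maximal stable set iff $\sum_{v\in S}\varphi(v)=1$. A strong clique is a clique meeting every maximal stable set. $H$ is a general partition graph if there are a set $U$ and non-empty $U_x\subseteq U$ ($x\in V(H)$) with $x,y$ adjacent iff $U_x\cap U_y\ne\emptyset$, such that for every maximal stable set $S$, $\{U_x:x\in S\}$ partitions $U$. -}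

module Defs where

open import Data.Bool.Base using (Bool; true; false; not; _∧_; _∨_; if_then_else_)
open import Data.Nat.Base using (ℕ; zero; suc; _+_; _∸_; _≤_; _<ᵇ_; ∣_-_∣; _%_)
open import Data.Fin.Base using (Fin; toℕ)
open import Data.Fin.Properties using () renaming (_≟_ to _≟ᶠ_)
open import Data.List.Base using (List; []; _∷_; [_]; allFin; concatMap; length; lookup; foldr)
open import Data.Product.Base using (Σ; _×_; _,_; ∃)
open import Data.Sum.Base using (_⊎_)
open import Data.Empty using (⊥)
open import Data.Rational using (ℚ; 0ℚ; 1ℚ; _<_) renaming (_+_ to _+ℚ_)
open import Relation.Nullary using (¬_)
open import Relation.Nullary.Decidable using (⌊_⌋)
open import Relation.Binary.PropositionalEquality using (_≡_; _≢_)
open import Function.Base using (_∘_)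
open import Function.Definitions using (Injective)
import Data.Nat.Base
import Data.Fin.Base
import Data.Nat.DivMod

Graph : ℕ → Set
Graph n = Fin n → Fin n → Bool

IsSimple : ∀ {n} → Graph n → Set
IsSimple {n} G = (∀ x y → G x y ≡ G y x) × (∀ x → G x x ≡ false)

_==ᶠ_ : ∀ {n} → Fin n → Fin n → Bool
x ==ᶠ y = ⌊ x ≟ᶠ y ⌋

TriangleFree : ∀ {n} → Graph n → Set
TriangleFree {n} G = ¬ (Σ (Fin n) λ x → Σ (Fin n) λ y → Σ (Fin n) λ z →
                         G x y ≡ true × G y z ≡ true × G x z ≡ true)

complement : ∀ {n} → Graph n → Graph n
complement G x y = not (x ==ᶠ y) ∧ not (G x y)

edges : ∀ {n} → Graph n → List (Fin n × Fin n)
edges {n} G = concatMap (λ i → concatMap (λ j →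
                if (toℕ i <ᵇ toℕ j) ∧ G i j then [ (i , j) ] else [])
                (allFin n)) (allFin n)

-- line graph: vertices are the edges of G (indexed by position in 'edges G');
-- two distinct edges are adjacent iff they share an endpoint
lineGraph : ∀ {n} (G : Graph n) → Graph (length (edges G))
lineGraph G k l with lookup (edges G) k | lookup (edges G) l
... | (i , j) | (i' , j') =
  not (k ==ᶠ l) ∧ ((i ==ᶠ i') ∨ (i ==ᶠ j') ∨ (j ==ᶠ i') ∨ (j ==ᶠ j'))

Subset : ℕ → Set
Subset m = Fin m → Bool

IsStable : ∀ {m} → Graph m → Subset m → Set
IsStable G S = ∀ x y → S x ≡ true → S y ≡ true → G x y ≡ false

IsMaximalStable : ∀ {m} → Graph m → Subset m → Set
IsMaximalStable {m} H S =
  IsStable H S × (∀ v → S v ≡ false → Σ (Fin m) λ u → S u ≡ true × H u v ≡ true)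

IsClique : ∀ {m} → Graph m → Subset m → Set
IsClique H C = ∀ x y → x ≢ y → C x ≡ true → C y ≡ true → H x y ≡ true

IsStrongClique : ∀ {m} → Graph m → Subset m → Set
IsStrongClique {m} H C = IsClique H C ×
  (∀ S → IsMaximalStable H S → Σ (Fin m) λ v → C v ≡ true × S v ≡ true)

weight : ∀ {m} → (Fin m → ℚ) → Subset m → ℚ
weight {m} φ S = foldr (λ v acc → (if S v then φ v else 0ℚ) +ℚ acc) 0ℚ (allFin m)

IsEquistable : ∀ {m} → Graph m → Set
IsEquistable {m} H = Σ (Fin m → ℚ) λ φ → (∀ v → 0ℚ < φ v) ×
  (∀ S → (IsMaximalStable H S → weight φ S ≡ 1ℚ) × (weight φ S ≡ 1ℚ → IsMaximalStable H S))

IsGeneralPartition : ∀ {m} → Graph m → Set₁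
IsGeneralPartition {m} H = Σ Set λ U → Σ (Fin m → U → Set) λ Mem →
  (∀ x → ∃ λ u → Mem x u) ×
  (∀ x y → x ≢ y → (H x y ≡ true → ∃ λ u → Mem x u × Mem y u)
                 × ((∃ λ u → Mem x u × Mem y u) → H x y ≡ true)) ×
  (∀ S → IsMaximalStable H S → ∀ u →
      (Σ (Fin m) λ x → S x ≡ true × Mem x u) ×
      (∀ x y → S x ≡ true → S y ≡ true → Mem x u → Mem y u → x ≡ y))

-- Bad graphs.  Vertex (cycle) positions 0 … n-1, n = suc m, arithmetic mod n.

module _ {m : ℕ} where
  private
    n : ℕ
    n = suc m

  nx : ℕ → ℕ
  nx x = (x + 1) % n

  dist : ℕ → ℕ → ℕ
  dist s t = ((t + n) ∸ s) % n

  -- cycle edge at position a is { a , a+1 }; disjointness of two cycle edges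
  DisjointCycleEdges : Fin n → Fin n → Set
  DisjointCycleEdges a b = toℕ a ≢ toℕ b × nx (toℕ a) ≢ toℕ b × nx (toℕ b) ≢ toℕ a

  -- P₀ for edges at positions a, b: the even-length one of the paths
  -- (a+1 → b) and (b+1 → a), given as (start position , length)
  P₀ : Fin n → Fin n → ℕ × ℕ
  P₀ a b =
    if (dist (nx (toℕ a)) (toℕ b) % 2) Data.Nat.Base.≡ᵇ 0
    then (nx (toℕ a) , dist (nx (toℕ a)) (toℕ b))
    else (nx (toℕ b) , dist (nx (toℕ b)) (toℕ a))

  -- chord of the Hamiltonian cycle σ between positions p and q
  IsChord : Graph n → (Fin n → Fin n) → Fin n → Fin n → Set
  IsChord G σ p q = G (σ p) (σ q) ≡ true × p ≢ q
                    × nx (toℕ p) ≢ toℕ q × nx (toℕ q) ≢ toℕ p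

  OnP : ℕ × ℕ → Fin n → Set
  OnP (s , L) p = dist s (toℕ p) ≤ L

  NonCrossingEvenChord : Graph n → (Fin n → Fin n) → Fin n → Fin n → Set
  NonCrossingEvenChord G σ a b with P₀ a b
  ... | (s , L) = Σ (Fin n) λ p → Σ (Fin n) λ q → IsChord G σ p q ×
        OnP (s , L) p × OnP (s , L) q × ∣ dist s (toℕ p) - dist s (toℕ q) ∣ % 2 ≡ 0

  -- the two distances from v to the ends of P₀ are  k  and  L ∸ k
  CrossingOddChord : Graph n → (Fin n → Fin n) → Fin n → Fin n → Set
  CrossingOddChord G σ a b with P₀ a b
  ... | (s , L) = Σ (Fin n) λ p → Σ (Fin n) λ q → IsChord G σ p q ×
        OnP (s , L) p × ¬ OnP (s , L) q ×
        dist s (toℕ p) % 2 ≡ 1 × (L ∸ dist s (toℕ p)) % 2 ≡ 1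

  BadS : Graph n → Set
  BadS G = n % 2 ≡ 1 × 3 ≤ n ×
    Σ (Fin n → Fin n) λ σ → Injective _≡_ _≡_ σ ×
      (∀ p → G (σ p) (σ (lookupNx p)) ≡ true) ×
      (∀ a b → DisjointCycleEdges a b →
         NonCrossingEvenChord G σ a b ⊎ CrossingOddChord G σ a b)
    where
    lookupNx : Fin n → Fin n
    lookupNx p = Data.Fin.Base.fromℕ< (Data.Nat.DivMod.m%n<n (toℕ p + 1) n)

-- order 0 is even, so no graph of order 0 is bad
Bad : ∀ {n} → Graph n → Set
Bad {zero} G = ⊥
Bad {suc m} G = BadS G

module Submission where

open import Defs
open import Data.Nat.Base as ℕ using (ℕ; zero; suc)
open import Data.Fin.Base using (Fin)
open import Data.Bool.Base using (true; false)
open import Data.Product.Base using (_×_; Σ; _,_)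
open import Data.Sum.Base using (_⊎_)
open import Relation.Nullary using (¬_)
open import Relation.Binary.PropositionalEquality using (_≡_)
open import Function.Definitions using (Injective)

-- Write H = complement (lineGraph G).  As G is triangle-free and every vertex has two distinct
-- neighbours on the Hamiltonian cycle, the maximal stable sets of H are exactly the stars of the
-- vertices of G.  A strong clique of H is then a perfect matching of G, impossible for odd n, and
-- a general partition graph always has a strong clique (double negated, constructively).
--
-- Equistability: give the chord with index l the weight M^l and the cycle edge a (a + 1) the
-- weight D - Σ_l M^l χ_a(l), where χ_a(l) is 1, -1 or 0 according as both, none or exactly one
-- of the ends of l lie at even distance after a + 1, and D = M^E with M > E + 1.  Since
-- χ_a(l) + χ_(a+1)(l) = [a + 1 ∈ l], every star weighs 2D.  Conversely, read in base M, a set S of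
-- weight 2D contains exactly two cycle edges a, b, and every chord l satisfies
-- [l ∈ S] = χ_a(l) + χ_b(l).  If a and b are consecutive, S is the star of their common vertex;
-- otherwise the chord supplied by badness has χ_a(l) + χ_b(l) ∉ {0 , 1}.

module Parity where

  open import Data.Nat.Base
  open import Data.Nat.Properties using (+-comm; +-identityʳ)
  open import Data.Nat.DivMod using ([m+n]%n≡m%n)
  open import Data.Bool.Base using (Bool; true; false; not; _xor_; if_then_else_)
  open import Data.Bool.Properties using (not-involutive; xor-same; not-distribˡ-xor; not-distribʳ-xor; xor-identityʳ)
  open import Relation.Binary.PropositionalEquality

  odd? : ℕ → Bool
  odd? zero = false
  odd? (suc n) = not (odd? n)

  odd?-+ : ∀ a b → odd? (a + b) ≡ odd? a xor odd? b
  odd?-+ zero b = refl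
  odd?-+ (suc a) b = trans (cong not (odd?-+ a b)) (not-distribˡ-xor (odd? a) (odd? b))

  odd?-2* : ∀ c → odd? (2 * c) ≡ false
  odd?-2* c = trans (cong odd? (cong (c +_) (+-identityʳ c))) (trans (odd?-+ c c) (xor-same (odd? c)))

  odd?-∣-∣ : ∀ x y → odd? ∣ x - y ∣ ≡ odd? x xor odd? y
  odd?-∣-∣ zero y = refl
  odd?-∣-∣ (suc x) zero = sym (xor-identityʳ _)
  odd?-∣-∣ (suc x) (suc y) = begin
    odd? ∣ x - y ∣                   ≡⟨ odd?-∣-∣ x y ⟩
    odd? x xor odd? y                ≡⟨ not-involutive _ ⟨
    not (not (odd? x xor odd? y))    ≡⟨ cong not (not-distribˡ-xor (odd? x) (odd? y)) ⟩
    not (not (odd? x) xor odd? y)    ≡⟨ not-distribʳ-xor (not (odd? x)) (odd? y) ⟩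
    not (odd? x) xor not (odd? y)    ∎
    where open ≡-Reasoning

  %2≡if-odd? : ∀ k → k % 2 ≡ (if odd? k then 1 else 0)
  %2≡if-odd? zero = refl
  %2≡if-odd? (suc zero) = refl
  %2≡if-odd? (suc (suc k)) = begin
    (2 + k) % 2                           ≡⟨ cong (_% 2) (+-comm 2 k) ⟩
    (k + 2) % 2                           ≡⟨ [m+n]%n≡m%n k 2 ⟩
    k % 2                                 ≡⟨ %2≡if-odd? k ⟩
    (if odd? k then 1 else 0)             ≡⟨ cong (if_then 1 else 0) (not-involutive (odd? k)) ⟨
    (if not (not (odd? k)) then 1 else 0) ∎
    where open ≡-Reasoning

  %2≡1⇒odd? : ∀ k → k % 2 ≡ 1 → odd? k ≡ true
  %2≡1⇒odd? k e with odd? k | %2≡if-odd? k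
  ... | true  | _  = refl
  ... | false | e′ with () ← trans (sym e′) e

  %2≡0⇒¬odd? : ∀ k → k % 2 ≡ 0 → odd? k ≡ false
  %2≡0⇒¬odd? k e with odd? k | %2≡if-odd? k
  ... | false | _  = refl
  ... | true  | e′ with () ← trans (sym e) e′

module CyclicDistance (m : ℕ) where

  open import Defs using (nx; dist)
  open Parity
  open import Data.Nat.Base
  open import Data.Nat.Properties
  open import Data.Nat.DivMod using (m<n⇒m%n≡m; [m+n]%n≡m%n; m%n<n)
  open import Data.Bool.Base using (true; false; not; _xor_)
  open import Data.Bool.Properties using (not-injective; not-involutive; xor-identityʳ; xor-comm; true-xor)
  open import Data.Product.Base using (_×_; _,_; proj₁; proj₂)
  open import Data.Sum.Base using (_⊎_; inj₁; inj₂)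
  open import Data.Empty using (⊥; ⊥-elim)
  open import Relation.Nullary using (yes; no)
  open import Relation.Binary.PropositionalEquality
  open import Data.Fin.Base using (toℕ; fromℕ<)
  open import Data.Fin.Properties using (toℕ-fromℕ<; toℕ<n; toℕ-injective)
  open import Function.Base using (case_of_)

  n : ℕ
  n = suc m

  IsForwardDist : ℕ → ℕ → ℕ → Set
  IsForwardDist x y d = d < n × (x + d ≡ y ⊎ x + d ≡ y + n)

  private
    +n-absurd : ∀ {x k y} → x ≤ n → k < n → x + k ≡ y + n + n → ⊥
    +n-absurd {x} {k} {y} x≤n k<n e = <⇒≱ (+-mono-≤-< x≤n k<n) (≤-trans (m≤n+m (n + n) y) (≤-reflexive (trans (sym (+-assoc y n n)) (sym e))))

    swap-n : ∀ a k → a + n + k ≡ a + k + n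
    swap-n a k = trans (+-assoc a n k) (trans (cong (a +_) (+-comm n k)) (sym (+-assoc a k n)))

    wrap-+ : ∀ {u v w k} → u ≡ v ⊎ u ≡ v + n → v + k ≡ w ⊎ v + k ≡ w + n → (u + k ≡ w ⊎ u + k ≡ w + n) ⊎ u + k ≡ w + n + n
    wrap-+ (inj₁ refl) vk = inj₁ vk
    wrap-+ {v = v} {k = k} (inj₂ refl) (inj₁ vk) = inj₁ (inj₂ (trans (swap-n v k) (cong (_+ n) vk)))
    wrap-+ {v = v} {k = k} (inj₂ refl) (inj₂ vk) = inj₂ (trans (swap-n v k) (cong (_+ n) vk))

  dist-isForwardDist : ∀ x y → x < n → y < n → IsForwardDist x y (dist {m} x y)
  dist-isForwardDist x y x<n y<n with x ≤? y
  ... | yes x≤y = subst (_< n) (sym e) (≤-<-trans (m∸n≤m y x) y<n) , inj₁ (trans (cong (x +_) e) (m+[n∸m]≡n x≤y))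
    where
    e : dist {m} x y ≡ y ∸ x
    e = trans (cong (_% n) (+-∸-comm n x≤y)) ((trans ([m+n]%n≡m%n (y ∸ x) n) (m<n⇒m%n≡m (≤-<-trans (m∸n≤m y x) y<n))))
  ... | no x≰y = subst (_< n) (sym e) lt , inj₂ (trans (cong (x +_) e) (m+[n∸m]≡n (≤-trans (<⇒≤ x<n) (m≤n+m n y))))
    where
    y<x : y < x
    y<x = ≰⇒> x≰y
    e0 : x + (y + n ∸ x) ≡ y + n
    e0 = m+[n∸m]≡n (≤-trans (<⇒≤ x<n) (m≤n+m n y))
    lt : y + n ∸ x < n
    lt = +-cancelˡ-< x (y + n ∸ x) n (subst (_< x + n) (sym e0) (+-monoˡ-< n y<x))
    e : dist {m} x y ≡ y + n ∸ x
    e = m<n⇒m%n≡m lt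

  isForwardDist-unique : ∀ x y d d' → IsForwardDist x y d → IsForwardDist x y d' → d ≡ d'
  isForwardDist-unique x y d d' (_ , inj₁ a) (_ , inj₁ b) = +-cancelˡ-≡ x d d' (trans a (sym b))
  isForwardDist-unique x y d d' (_ , inj₂ a) (_ , inj₂ b) = +-cancelˡ-≡ x d d' (trans a (sym b))
  isForwardDist-unique x y d d' (_ , inj₁ a) (d'<n , inj₂ b) = ⊥-elim (<⇒≱ d'<n (≤-trans (m≤n+m n d) (≤-reflexive (sym e))))
    where
    e : d' ≡ d + n
    e = +-cancelˡ-≡ x d' (d + n) (trans b (trans (cong (_+ n) (sym a)) (+-assoc x d n)))
  isForwardDist-unique x y d d' (d<n , inj₂ a) (_ , inj₁ b) = ⊥-elim (<⇒≱ d<n (≤-trans (m≤n+m n d') (≤-reflexive (sym e))))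
    where
    e : d ≡ d' + n
    e = +-cancelˡ-≡ x d (d' + n) (trans a (trans (cong (_+ n) (sym b)) (+-assoc x d' n)))

  dist≡ : ∀ x y d → x < n → y < n → IsForwardDist x y d → dist {m} x y ≡ d
  dist≡ x y d x<n y<n c = isForwardDist-unique x y _ d (dist-isForwardDist x y x<n y<n) c

  nx<n : ∀ x → nx {m} x < n
  nx<n x = m%n<n (x + 1) n

  nx-wrap : ∀ x → x < n → x + 1 ≡ nx {m} x ⊎ x + 1 ≡ nx {m} x + n
  nx-wrap x x<n with x + 1 <? n
  ... | yes lt = inj₁ (sym (m<n⇒m%n≡m lt))
  ... | no ¬lt = inj₂ (trans x+1≡n (cong (_+ n) (sym nx≡0)))
    where
    x+1≡n : x + 1 ≡ n
    x+1≡n = ≤-antisym (subst (_≤ n) (+-comm 1 x) x<n) (≮⇒≥ ¬lt)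
    nx≡0 : nx {m} x ≡ 0
    nx≡0 = trans (cong (_% n) x+1≡n) ([m+n]%n≡m%n 0 n)

  dist-refl : ∀ s → s < n → dist {m} s s ≡ 0
  dist-refl s s<n = dist≡ s s 0 s<n s<n (s≤s z≤n , inj₁ (+-identityʳ s))

  dist-nx-self : ∀ s → s < n → dist {m} (nx {m} s) s ≡ m
  dist-nx-self s s<n = dist≡ (nx {m} s) s m (nx<n s) s<n (≤-refl , c (nx-wrap s s<n))
    where
    c : s + 1 ≡ nx {m} s ⊎ s + 1 ≡ nx {m} s + n → nx {m} s + m ≡ s ⊎ nx {m} s + m ≡ s + n
    c (inj₁ e) = inj₂ (trans (cong (_+ m) (sym e)) (+-assoc s 1 m))
    c (inj₂ e) = inj₁ (+-cancelʳ-≡ n (nx {m} s + m) s (trans (sym (swap-n (nx {m} s) m)) (trans (cong (_+ m) (sym e)) (+-assoc s 1 m))))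

  isForwardDist-injective : ∀ s x y d → x < n → y < n → IsForwardDist s x d → IsForwardDist s y d → x ≡ y
  isForwardDist-injective s x y d x<n y<n (_ , a) (_ , b) = go a b
    where
    go : s + d ≡ x ⊎ s + d ≡ x + n → s + d ≡ y ⊎ s + d ≡ y + n → x ≡ y
    go (inj₁ a) (inj₁ b) = trans (sym a) b
    go (inj₂ a) (inj₂ b) = +-cancelʳ-≡ n x y (trans (sym a) b)
    go (inj₁ a) (inj₂ b) = ⊥-elim (<⇒≱ x<n (≤-trans (m≤n+m n y) (≤-reflexive (trans (sym b) a))))
    go (inj₂ a) (inj₁ b) = ⊥-elim (<⇒≱ y<n (≤-trans (m≤n+m n x) (≤-reflexive (trans (sym a) b))))

  dist-suc : ∀ s t → s < n → t < n → s ≢ t → dist {m} s t ≡ suc (dist {m} (nx {m} s) t)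
  dist-suc s t s<n t<n s≢t = dist≡ s t (suc d) s<n t<n (suc-d<n , reaches)
    where
    d = dist {m} (nx {m} s) t
    d<n = proj₁ (dist-isForwardDist (nx {m} s) t (nx<n s) t<n)
    s+1+d : (s + 1 + d ≡ t ⊎ s + 1 + d ≡ t + n) ⊎ s + 1 + d ≡ t + n + n
    s+1+d = wrap-+ (nx-wrap s s<n) (proj₂ (dist-isForwardDist (nx {m} s) t (nx<n s) t<n))
    reaches : s + suc d ≡ t ⊎ s + suc d ≡ t + n
    reaches with s+1+d
    ... | inj₁ r = subst (λ z → z ≡ t ⊎ z ≡ t + n) (+-assoc s 1 d) r
    ... | inj₂ r = ⊥-elim (+n-absurd (subst (_≤ n) (+-comm 1 s) s<n) d<n r)
    suc-d<n : suc d < n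
    suc-d<n with m≤n⇒m<n∨m≡n d<n
    ... | inj₁ lt = lt
    ... | inj₂ suc-d≡n with reaches
    ...   | inj₁ e = ⊥-elim (<⇒≱ t<n (≤-trans (m≤n+m n s) (≤-reflexive (trans (cong (s +_) (sym suc-d≡n)) e))))
    ...   | inj₂ e = ⊥-elim (s≢t (+-cancelʳ-≡ n s t (trans (cong (s +_) (sym suc-d≡n)) e)))

  dist-split≤ : ∀ s x y → s < n → x < n → y < n → dist {m} s x ≤ dist {m} s y → dist {m} x y + dist {m} s x ≡ dist {m} s y
  dist-split≤ s x y s<n x<n y<n a≤b = trans (cong (_+ a) (dist≡ x y e x<n y<n (e<n , reaches (proj₂ sx) (proj₂ sy)))) e+a
    where
    a = dist {m} s x
    b = dist {m} s y
    sx = dist-isForwardDist s x s<n x<n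
    sy = dist-isForwardDist s y s<n y<n
    e = b ∸ a
    e+a : e + a ≡ b
    e+a = m∸n+n≡m a≤b
    e<n : e < n
    e<n = ≤-<-trans (m∸n≤m b a) (proj₁ sy)
    s+b : s + a + e ≡ s + b
    s+b = trans (+-assoc s a e) (cong (s +_) (trans (+-comm a e) e+a))
    reaches : s + a ≡ x ⊎ s + a ≡ x + n → s + b ≡ y ⊎ s + b ≡ y + n → x + e ≡ y ⊎ x + e ≡ y + n
    reaches (inj₁ sa) sb = subst (λ z → z ≡ y ⊎ z ≡ y + n) (trans (sym s+b) (cong (_+ e) sa)) sb
    reaches (inj₂ sa) (inj₁ sb) = ⊥-elim (<⇒≱ y<n (≤-trans (m≤n+m n x) (≤-trans (≤-reflexive (sym sa)) (≤-trans (+-monoʳ-≤ s a≤b) (≤-reflexive sb)))))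
    reaches (inj₂ sa) (inj₂ sb) = inj₁ (+-cancelʳ-≡ n (x + e) y (trans (sym (swap-n x e)) (trans (cong (_+ e) (sym sa)) (trans s+b sb))))

  dist-split> : ∀ s x y → s < n → x < n → y < n → dist {m} s y < dist {m} s x → dist {m} x y + dist {m} s x ≡ dist {m} s y + n
  dist-split> s x y s<n x<n y<n b<a = trans (cong (_+ a) (dist≡ x y e x<n y<n (e<n , reaches (proj₂ sx) (proj₂ sy)))) e+a
    where
    a = dist {m} s x
    b = dist {m} s y
    sx = dist-isForwardDist s x s<n x<n
    sy = dist-isForwardDist s y s<n y<n
    e = b + n ∸ a
    e+a : e + a ≡ b + n
    e+a = m∸n+n≡m (≤-trans (<⇒≤ (proj₁ sx)) (m≤n+m n b))
    e<n : e < n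
    e<n = +-cancelʳ-< a e n (subst (_< n + a) (sym e+a) (subst (b + n <_) (+-comm a n) (+-monoˡ-< n b<a)))
    s+b+n : s + a + e ≡ s + b + n
    s+b+n = trans (+-assoc s a e) (trans (cong (s +_) (trans (+-comm a e) e+a)) (sym (+-assoc s b n)))
    reaches : s + a ≡ x ⊎ s + a ≡ x + n → s + b ≡ y ⊎ s + b ≡ y + n → x + e ≡ y ⊎ x + e ≡ y + n
    reaches (inj₁ sa) (inj₁ sb) = inj₂ (trans (cong (_+ e) (sym sa)) (trans s+b+n (cong (_+ n) sb)))
    reaches (inj₁ sa) (inj₂ sb) = ⊥-elim (+n-absurd (<⇒≤ x<n) e<n (trans (cong (_+ e) (sym sa)) (trans s+b+n (cong (_+ n) sb))))
    reaches (inj₂ sa) sb = subst (λ z → z ≡ y ⊎ z ≡ y + n) (+-cancelʳ-≡ n (s + b) (x + e) (trans (sym s+b+n) (trans (cong (_+ e) sa) (swap-n x e)))) sb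

  next : Fin n → Fin n
  next p = fromℕ< (m%n<n (toℕ p + 1) n)

  toℕ-next : ∀ p → toℕ (next p) ≡ nx {m} (toℕ p)
  toℕ-next p = toℕ-fromℕ< (m%n<n (toℕ p + 1) n)

  dist-next-self : ∀ p → dist {m} (toℕ (next p)) (toℕ p) ≡ m
  dist-next-self p = trans (cong (λ z → dist {m} z (toℕ p)) (toℕ-next p)) (dist-nx-self (toℕ p) (toℕ<n p))

  next-injective : ∀ p q → next p ≡ next q → p ≡ q
  next-injective p q e = toℕ-injective (isForwardDist-injective (toℕ (next p)) (toℕ p) (toℕ q) m (toℕ<n p) (toℕ<n q)
    (subst (IsForwardDist (toℕ (next p)) (toℕ p)) (dist-next-self p) (dist-isForwardDist _ _ (toℕ<n (next p)) (toℕ<n p)))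
    (subst (IsForwardDist (toℕ (next p)) (toℕ q)) (trans (cong (λ z → dist {m} (toℕ z) (toℕ q)) e) (dist-next-self q))
      (dist-isForwardDist _ _ (toℕ<n (next p)) (toℕ<n q))))

  module Order≥3 (2≤m : 2 ≤ m) where

    next≢ : ∀ p → next p ≢ p
    next≢ p e = case subst (2 ≤_) m≡0 2≤m of λ ()
      where
      m≡0 : m ≡ 0
      m≡0 = trans (sym (dist-next-self p)) (trans (cong (λ z → dist {m} (toℕ z) (toℕ p)) e) (dist-refl (toℕ p) (toℕ<n p)))

    next²≢ : ∀ p → next (next p) ≢ p
    next²≢ p e = case subst (2 ≤_) m≡1 2≤m of λ { (s≤s ()) }
      where
      q = next p
      dist-next : dist {m} (toℕ q) (toℕ (next q)) ≡ 1
      dist-next = trans (cong (dist {m} (toℕ q)) (toℕ-next q))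
        (dist≡ (toℕ q) (nx {m} (toℕ q)) 1 (toℕ<n q) (nx<n (toℕ q)) (s≤s (≤-trans (s≤s z≤n) 2≤m) , nx-wrap (toℕ q) (toℕ<n q)))
      m≡1 : m ≡ 1
      m≡1 = trans (sym (dist-next-self p)) (trans (cong (λ z → dist {m} (toℕ q) (toℕ z)) (sym e)) dist-next)

  -- The cycle edges at positions a and b cut the cycle into the paths s = a + 1, …, b of length L
  -- and b + 1, …, a.
  module TwoCycleEdges (m-even : odd? m ≡ false) (a b : ℕ) (a<n : a < n) (b<n : b < n) (a≢b : a ≢ b) where
    s = nx {m} a
    s<n = nx<n a
    L = dist {m} s b

    private
      odd?-suc-+ : ∀ d k → odd? (suc d + k) ≡ not (odd? d) xor odd? k
      odd?-suc-+ d k = odd?-+ (suc d) k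

      odd?-+n : ∀ k → odd? (k + n) ≡ not (odd? k)
      odd?-+n k = begin
        odd? (k + suc m)        ≡⟨ cong odd? (+-suc k m) ⟩
        not (odd? (k + m))      ≡⟨ cong not (odd?-+ k m) ⟩
        not (odd? k xor odd? m) ≡⟨ cong (λ b → not (odd? k xor b)) m-even ⟩
        not (odd? k xor false)  ≡⟨ cong not (xor-identityʳ (odd? k)) ⟩
        not (odd? k)            ∎
        where open ≡-Reasoning

      odd?-suc-+-even : ∀ d → odd? L ≡ false → odd? (suc d + L) ≡ not (odd? d)
      odd?-suc-+-even d eL = trans (odd?-suc-+ d L) (trans (cong (not (odd? d) xor_) eL) (xor-identityʳ _))

    parity-onPath : odd? L ≡ false → ∀ p → p < n → dist {m} s p ≤ L → odd? (dist {m} (nx {m} b) p) ≡ odd? (dist {m} s p)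
    parity-onPath eL p p<n le with p ≟ b
    ... | yes refl = trans (cong odd? (dist-nx-self p p<n)) (trans m-even (sym eL))
    ... | no p≢b with m≤n⇒m<n∨m≡n le
    ... | inj₂ eq = ⊥-elim (p≢b (isForwardDist-injective s p b _ p<n b<n (dist-isForwardDist s p s<n p<n) (subst (IsForwardDist s b) (sym eq) (dist-isForwardDist s b s<n b<n))))
    ... | inj₁ lt = not-injective (trans (sym (odd?-suc-+-even (dist {m} (nx {m} b) p) eL)) (trans (cong odd? split) (odd?-+n (dist {m} s p))))
      where
      split : suc (dist {m} (nx {m} b) p) + L ≡ dist {m} s p + n
      split = trans (cong (_+ L) (sym (dist-suc b p b<n p<n (λ e → p≢b (sym e))))) (dist-split> s b p s<n b<n p<n lt)

    parity-offPath : odd? L ≡ false → ∀ q → q < n → L < dist {m} s q → odd? (dist {m} (nx {m} b) q) ≡ not (odd? (dist {m} s q))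
    parity-offPath eL q q<n lt with q ≟ b
    ... | yes refl = ⊥-elim (<-irrefl refl lt)
    ... | no q≢b = trans (sym (not-involutive _)) (cong not (trans (sym (odd?-suc-+-even (dist {m} (nx {m} b) q) eL)) (cong odd? split)))
      where
      split : suc (dist {m} (nx {m} b) q) + L ≡ dist {m} s q
      split = trans (cong (_+ L) (sym (dist-suc b q b<n q<n (λ e → q≢b (sym e))))) (dist-split≤ s b q s<n b<n q<n (<⇒≤ lt))

    otherPath-even : odd? L ≡ true → odd? (dist {m} (nx {m} b) a) ≡ false
    otherPath-even oL = begin
      odd? d                          ≡⟨ not-involutive (odd? d) ⟨
      not (not (odd? d))              ≡⟨ true-xor (not (odd? d)) ⟨
      true xor not (odd? d)           ≡⟨ xor-comm true (not (odd? d)) ⟩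
      not (odd? d) xor true           ≡⟨ cong (not (odd? d) xor_) oL ⟨
      not (odd? d) xor odd? L         ≡⟨ odd?-suc-+ d L ⟨
      odd? (suc d + L)                ≡⟨ cong odd? split ⟩
      odd? m                          ≡⟨ m-even ⟩
      false                           ∎
      where
      d = dist {m} (nx {m} b) a
      open ≡-Reasoning
      L≤ : L ≤ dist {m} s a
      L≤ = subst (L ≤_) (sym (dist-nx-self a a<n)) (s≤s⁻¹ (proj₁ (dist-isForwardDist s b s<n b<n)))
      split : suc d + L ≡ m
      split = trans (cong (_+ L) (sym (dist-suc b a b<n a<n (λ e → a≢b (sym e))))) (trans (dist-split≤ s b a s<n b<n a<n L≤) (dist-nx-self a a<n))

module IntegerSums where

  open import Data.Nat.Base as ℕ using (ℕ; zero; suc)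
  import Data.Nat.Properties as ℕ
  open import Data.Integer.Base hiding (suc; pred)
  open import Data.Integer.Properties
  open import Data.Fin.Base using (Fin; zero; suc)
  open import Data.Fin.Properties using (suc-injective) renaming (_≟_ to _≟ᶠ_)
  open import Data.Bool.Base using (Bool; true; false; _∧_; if_then_else_)
  open import Data.Product.Base using (Σ; _×_; _,_)
  open import Data.Sum.Base as Sum using (_⊎_; inj₁; inj₂)
  open import Data.Empty using (⊥-elim)
  open import Relation.Nullary using (yes; no)
  open import Relation.Nullary.Decidable using (⌊_⌋)
  open import Function.Base using (_∘_; case_of_)
  open import Relation.Binary.PropositionalEquality
  open import Algebra.Properties.Semiring.Sum +-*-semiring public

  when : Bool → ℤ → ℤ
  when true  z = z
  when false z = + 0

  when-+ : ∀ b x y → when b (x + y) ≡ when b x + when b y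
  when-+ true  x y = refl
  when-+ false x y = refl

  when-*ˡ : ∀ b c x → when b (c * x) ≡ c * when b x
  when-*ˡ true  c x = refl
  when-*ˡ false c x = sym (*-zeroʳ c)

  when-∧ : ∀ b c x → when b (when c x) ≡ when (b ∧ c) x
  when-∧ true  c x = refl
  when-∧ false c x = refl

  when≡when1* : ∀ b x → when b x ≡ when b (+ 1) * x
  when≡when1* true  x = sym (*-identityˡ x)
  when≡when1* false x = refl

  ∣when∣≤ : ∀ b {x k} → ∣ x ∣ ℕ.≤ k → ∣ when b x ∣ ℕ.≤ k
  ∣when∣≤ true  h = h
  ∣when∣≤ false h = ℕ.z≤n

  sum-zero : ∀ {E} (f : Fin E → ℤ) → (∀ i → f i ≡ + 0) → sum f ≡ + 0
  sum-zero {E} f h = trans (sum-cong-≗ h) (sum-replicate-zero E)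

  when-sum : ∀ {E} b (f : Fin E → ℤ) → when b (sum f) ≡ sum (λ i → when b (f i))
  when-sum true  f = refl
  when-sum false f = sym (sum-zero (λ i → when false (f i)) (λ _ → refl))

  sum-*ˡ : ∀ {E} c (f : Fin E → ℤ) → sum (λ i → c * f i) ≡ c * sum f
  sum-*ˡ c f = sym (*-distribˡ-sum c f)

  sum-neg : ∀ {E} (f : Fin E → ℤ) → sum (λ i → - f i) ≡ - sum f
  sum-neg f = begin
    sum (λ i → - f i)     ≡⟨ sum-cong-≗ (λ i → -1*i≡-i (f i)) ⟨
    sum (λ i → -1ℤ * f i) ≡⟨ sum-*ˡ -1ℤ f ⟩
    -1ℤ * sum f           ≡⟨ -1*i≡-i (sum f) ⟩
    - sum f               ∎
    where open ≡-Reasoning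

  sum-const1 : ∀ E → sum {E} (λ _ → + 1) ≡ + E
  sum-const1 zero    = refl
  sum-const1 (suc E) = cong (_+_ 1ℤ) (sum-const1 E)

  ∣sum∣≤ : ∀ {E} (f : Fin E → ℤ) (B : ℕ) → (∀ i → ∣ f i ∣ ℕ.≤ B) → ∣ sum f ∣ ℕ.≤ E ℕ.* B
  ∣sum∣≤ {zero}  f B h = ℕ.z≤n
  ∣sum∣≤ {suc E} f B h = ℕ.≤-trans (∣i+j∣≤∣i∣+∣j∣ (f zero) _)
    (ℕ.+-mono-≤ (h zero) (∣sum∣≤ (λ i → f (suc i)) B (λ i → h (suc i))))

  sum-single : ∀ {E} (f : Fin E → ℤ) (k : Fin E) → (∀ i → i ≢ k → f i ≡ + 0) → sum f ≡ f k
  sum-single {suc E} f zero h = trans (cong (_+_ (f zero)) (sum-zero _ (λ i → h (suc i) (λ ())))) (+-identityʳ (f zero))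
  sum-single {suc E} f (suc k) h = trans (cong (_+ sum (λ i → f (suc i))) (h zero (λ ())))
    (trans (+-identityˡ _) (sum-single (λ i → f (suc i)) k (λ i ne → h (suc i) (ne ∘ suc-injective))))

  sum-pair : ∀ {E} (f : Fin E → ℤ) (k l : Fin E) → k ≢ l →
    (∀ i → i ≢ k → i ≢ l → f i ≡ + 0) → sum f ≡ f k + f l
  sum-pair f k l k≢l h = begin
    sum f                         ≡⟨ sum-cong-≗ split ⟩
    sum (λ i → at-k i + off-k i)  ≡⟨ ∑-distrib-+ at-k off-k ⟩
    sum at-k + sum off-k          ≡⟨ cong₂ _+_ (sum-single at-k k at-k-zero) (sum-single off-k l off-k-zero) ⟩
    at-k k + off-k l              ≡⟨ cong₂ _+_ at-k-k off-k-l ⟩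
    f k + f l                     ∎
    where
    open ≡-Reasoning
    at-k off-k : _ → ℤ
    at-k  i = if ⌊ i ≟ᶠ k ⌋ then f i else + 0
    off-k i = if ⌊ i ≟ᶠ k ⌋ then + 0 else f i
    split : ∀ i → f i ≡ at-k i + off-k i
    split i with i ≟ᶠ k
    ... | yes _ = sym (+-identityʳ (f i))
    ... | no  _ = sym (+-identityˡ (f i))
    at-k-zero : ∀ i → i ≢ k → at-k i ≡ + 0
    at-k-zero i i≢k with i ≟ᶠ k
    ... | yes i≡k = ⊥-elim (i≢k i≡k)
    ... | no  _   = refl
    off-k-zero : ∀ i → i ≢ l → off-k i ≡ + 0
    off-k-zero i i≢l with i ≟ᶠ k
    ... | yes _   = refl
    ... | no  i≢k = h i i≢k i≢l
    at-k-k : at-k k ≡ f k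
    at-k-k with k ≟ᶠ k
    ... | yes _   = refl
    ... | no  k≢k = ⊥-elim (k≢k refl)
    off-k-l : off-k l ≡ f l
    off-k-l with l ≟ᶠ k
    ... | yes l≡k = ⊥-elim (k≢l (sym l≡k))
    ... | no  _   = refl

  count : ∀ {E} → (Fin E → Bool) → ℕ
  count {zero}  P = 0
  count {suc E} P = (if P zero then 1 else 0) ℕ.+ count (λ i → P (suc i))

  sum-when1≡count : ∀ {E} (P : Fin E → Bool) → sum (λ i → when (P i) (+ 1)) ≡ + count P
  sum-when1≡count {zero}  P = refl
  sum-when1≡count {suc E} P with P zero
  ... | true  = cong (_+_ 1ℤ) (sum-when1≡count (λ i → P (suc i)))
  ... | false = trans (+-identityˡ _) (sum-when1≡count (λ i → P (suc i)))

  count≡0 : ∀ {E} (P : Fin E → Bool) → count P ≡ 0 → ∀ i → P i ≡ false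
  count≡0 {suc E} P e i with P zero in P0
  count≡0 {suc E} P () i       | true
  count≡0 {suc E} P e zero     | false = P0
  count≡0 {suc E} P e (suc i)  | false = count≡0 (λ i → P (suc i)) e i

  count≡1 : ∀ {E} (P : Fin E → Bool) → count P ≡ 1 →
    Σ (Fin E) λ k → P k ≡ true × (∀ i → P i ≡ true → i ≡ k)
  count≡1 {suc E} P e with P zero in P0
  ... | true = zero , P0 , λ
    { zero _ → refl
    ; (suc i) Pi → case trans (sym Pi) (count≡0 (λ i → P (suc i)) (ℕ.suc-injective e) i) of λ () }
  ... | false with count≡1 (λ i → P (suc i)) e
  ...   | k , Pk , only = suc k , Pk , λ
    { zero Pz → case trans (sym P0) Pz of λ ()
    ; (suc i) Pi → cong suc (only i Pi) }

  count≡2 : ∀ {E} (P : Fin E → Bool) → count P ≡ 2 →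
    Σ (Fin E) λ k → Σ (Fin E) λ k′ → k ≢ k′ × P k ≡ true × P k′ ≡ true × (∀ i → P i ≡ true → i ≡ k ⊎ i ≡ k′)
  count≡2 {suc E} P e with P zero in P0
  ... | true with count≡1 (λ i → P (suc i)) (ℕ.suc-injective e)
  ...   | k , Pk , only = zero , suc k , (λ ()) , P0 , Pk , λ
    { zero _ → inj₁ refl
    ; (suc i) Pi → inj₂ (cong suc (only i Pi)) }
  count≡2 {suc E} P e | false with count≡2 (λ i → P (suc i)) e
  ... | k , k′ , k≢k′ , Pk , Pk′ , only = suc k , suc k′ , (λ eq → k≢k′ (suc-injective eq)) , Pk , Pk′ , λ
    { zero Pz → case trans (sym P0) Pz of λ ()
    ; (suc i) Pi → Sum.map (cong suc) (cong suc) (only i Pi) }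

module BaseExpansion where

  open IntegerSums
  open import Data.Nat.Base as ℕ using (ℕ; zero; suc; _^_)
  import Data.Nat.Properties as ℕ
  open import Data.Integer.Base hiding (suc; pred; _^_)
  open import Data.Integer.Properties
  open import Data.Integer.Tactic.RingSolver using (solve-∀)
  open import Data.Fin.Base using (Fin; zero; suc; toℕ)
  open import Data.Product.Base using (_×_; _,_)
  open import Data.Empty using (⊥-elim)
  open import Relation.Binary.PropositionalEquality

  module _ (M : ℕ) where

    private
      horner : ∀ {E} → (Fin E → ℤ) → ℤ
      horner {zero}  c = + 0
      horner {suc E} c = c zero + + M * horner (λ i → c (suc i))

      ∑pow≡horner : ∀ {E} (c : Fin E → ℤ) → ∑[ l < E ] (+ (M ^ toℕ l) * c l) ≡ horner c
      ∑pow≡horner {zero}  c = refl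
      ∑pow≡horner {suc E} c = cong₂ _+_ (*-identityˡ (c zero)) (begin
        ∑[ l < E ] (+ (M ℕ.* M ^ toℕ l) * c (suc l))   ≡⟨ sum-cong-≗ (λ l → trans (cong (_* c (suc l)) (pos-* M (M ^ toℕ l))) (*-assoc (+ M) _ _)) ⟩
        ∑[ l < E ] (+ M * (+ (M ^ toℕ l) * c (suc l))) ≡⟨ sum-*ˡ (+ M) (λ l → + (M ^ toℕ l) * c (suc l)) ⟩
        + M * ∑[ l < E ] (+ (M ^ toℕ l) * c (suc l))   ≡⟨ cong (+ M *_) (∑pow≡horner (λ i → c (suc i))) ⟩
        + M * horner (λ i → c (suc i))                  ∎)
        where open ≡-Reasoning

    module _ {B : ℕ} (B<M : B ℕ.< M) where

      private
        ∣horner∣< : ∀ {E} (c : Fin E → ℤ) → (∀ l → ∣ c l ∣ ℕ.≤ B) → ∣ horner c ∣ ℕ.< M ^ E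
        ∣horner∣< {zero}  c h = ℕ.s≤s ℕ.z≤n
        ∣horner∣< {suc E} c h = ℕ.≤-trans (ℕ.s≤s (ℕ.≤-trans (∣i+j∣≤∣i∣+∣j∣ (c zero) _)
             (ℕ.+-mono-≤ (h zero) (ℕ.≤-reflexive (∣i*j∣≡∣i∣*∣j∣ (+ M) d)))))
           (ℕ.≤-trans (ℕ.+-monoˡ-≤ (M ℕ.* ∣ d ∣) B<M)
             (ℕ.≤-trans (ℕ.≤-reflexive (sym (ℕ.*-suc M ∣ d ∣))) (ℕ.*-monoʳ-≤ M (∣horner∣< (λ i → c (suc i)) (λ i → h (suc i))))))
          where
          d = horner (λ i → c (suc i))

        horner≡0 : ∀ {E} (c : Fin E → ℤ) → (∀ l → ∣ c l ∣ ℕ.≤ B) → horner c ≡ + 0 → ∀ l → c l ≡ + 0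
        horner≡0 {suc E} c h eq = go ∣ d ∣ refl
          where
          d = horner (λ i → c (suc i))
          c₀≡ : c zero ≡ - (+ M * d)
          c₀≡ = trans (shift (c zero) (+ M * d)) (trans (cong (_- (+ M * d)) eq) (+-identityˡ _))
            where
            shift : ∀ a b → a ≡ (a + b) - b
            shift = solve-∀
          go : (k : ℕ) → ∣ d ∣ ≡ k → ∀ l → c l ≡ + 0
          go (suc k) ∣d∣≡ _ = ⊥-elim (ℕ.<⇒≱ B<M (ℕ.≤-trans (ℕ.m≤m*n M (suc k)) (ℕ.≤-trans (ℕ.≤-reflexive (sym ∣c₀∣≡)) (h zero))))
            where
            ∣c₀∣≡ : ∣ c zero ∣ ≡ M ℕ.* suc k
            ∣c₀∣≡ = trans (cong ∣_∣ c₀≡) (trans (∣-i∣≡∣i∣ (+ M * d)) (trans (∣i*j∣≡∣i∣*∣j∣ (+ M) d) (cong (M ℕ.*_) ∣d∣≡)))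
          go zero ∣d∣≡ zero = trans c₀≡ (trans (cong (λ x → - (+ M * x)) d≡0) (cong -_ (*-zeroʳ (+ M))))
            where d≡0 = ∣i∣≡0⇒i≡0 ∣d∣≡
          go zero ∣d∣≡ (suc l) = horner≡0 (λ i → c (suc i)) (λ i → h (suc i)) (∣i∣≡0⇒i≡0 ∣d∣≡) l

      ∣∑pow∣< : ∀ {E} (c : Fin E → ℤ) → (∀ l → ∣ c l ∣ ℕ.≤ B) → ∣ ∑[ l < E ] (+ (M ^ toℕ l) * c l) ∣ ℕ.< M ^ E
      ∣∑pow∣< c h = subst (λ z → ∣ z ∣ ℕ.< _) (sym (∑pow≡horner c)) (∣horner∣< c h)

      ∑pow≡0⇒≡0 : ∀ {E} (c : Fin E → ℤ) → (∀ l → ∣ c l ∣ ℕ.≤ B) → ∑[ l < E ] (+ (M ^ toℕ l) * c l) ≡ + 0 → ∀ l → c l ≡ + 0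
      ∑pow≡0⇒≡0 c h eq = horner≡0 c h (trans (sym (∑pow≡horner c)) eq)

  N*P+R≡2*P⇒ : ∀ (N P : ℕ) (R : ℤ) → ∣ R ∣ ℕ.< P → + N * + P + R ≡ + 2 * + P → N ≡ 2 × R ≡ + 0
  N*P+R≡2*P⇒ N P R ∣R∣<P eq = go ∣ + 2 - + N ∣ refl
    where
    R≡ : R ≡ (+ 2 - + N) * + P
    R≡ = begin
      R                                               ≡⟨ rearrange (+ N) (+ P) R ⟩
      (+ 2 - + N) * + P + (+ N * + P + R - + 2 * + P) ≡⟨ cong (_+_ ((+ 2 - + N) * + P)) (i≡j⇒i-j≡0 eq) ⟩
      (+ 2 - + N) * + P + + 0                         ≡⟨ +-identityʳ _ ⟩
      (+ 2 - + N) * + P                               ∎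
      where
      open ≡-Reasoning
      rearrange : ∀ n p r → r ≡ (+ 2 - n) * p + (n * p + r - + 2 * p)
      rearrange = solve-∀
    go : ∀ k → ∣ + 2 - + N ∣ ≡ k → N ≡ 2 × R ≡ + 0
    go zero e = +-injective (sym (i-j≡0⇒i≡j (+ 2) (+ N) 2-N≡0)) , trans R≡ (cong (_* + P) 2-N≡0)
      where 2-N≡0 = ∣i∣≡0⇒i≡0 e
    go (suc k) e = ⊥-elim (ℕ.<⇒≱ ∣R∣<P (ℕ.≤-trans (ℕ.m≤n*m P (suc k))
      (ℕ.≤-reflexive (sym (trans (cong ∣_∣ R≡) (trans (∣i*j∣≡∣i∣*∣j∣ (+ 2 - + N) (+ P)) (cong (ℕ._* P) e)))))))

module FinSurjection where

  open import Data.Nat.Properties using (<-irrefl)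
  open import Data.Fin.Base using (punchOut)
  open import Data.Fin.Properties using (any?; punchOut-injective; injective⇒≤) renaming (_≟_ to _≟ᶠ_)
  open import Data.Empty using (⊥-elim)
  open import Relation.Nullary using (yes; no)
  open import Relation.Binary.PropositionalEquality using (refl; sym)

  injective⇒surjective : ∀ {k} (f : Fin k → Fin k) → Injective _≡_ _≡_ f → ∀ i → Σ (Fin k) λ p → f p ≡ i
  injective⇒surjective {suc k} f f-injective i with any? (λ p → f p ≟ᶠ i)
  ... | yes found = found
  ... | no ¬found = ⊥-elim (<-irrefl refl (injective⇒≤ {f = g} g-injective))
    where
    g : Fin (suc k) → Fin k
    g p = punchOut {i = i} (λ e → ¬found (p , sym e))
    g-injective : Injective _≡_ _≡_ g
    g-injective {p} {q} e = f-injective (punchOut-injective (λ e′ → ¬found (p , sym e′)) (λ e′ → ¬found (q , sym e′)) e)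

module EdgeEnumeration where

  open import Defs
  open import Data.Nat.Base using (ℕ; zero; suc; _<_; _<ᵇ_)
  open import Data.Nat.Properties using (<ᵇ⇒<; <⇒<ᵇ)
  open import Data.Fin.Base using (Fin; zero; suc; toℕ)
  open import Data.Bool.Base using (true; false; if_then_else_; _∧_; T)
  open import Data.List.Base using (List; []; _∷_; [_]; allFin; concatMap; length; lookup)
  open import Data.List.Relation.Unary.Any as Any using (here)
  import Data.List.Relation.Unary.All as All
  open import Data.List.Relation.Unary.AllPairs using ([]; _∷_)
  open import Data.List.Relation.Unary.Any.Properties using (lookup-index)
  open import Data.List.Relation.Unary.Unique.Propositional using (Unique)
  open import Data.List.Relation.Unary.Unique.Propositional.Properties using (++⁺; allFin⁺)
  open import Data.List.Membership.Propositional using (_∈_; find)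
  open import Data.List.Membership.Propositional.Properties using (∈-concatMap⁻; ∈-concatMap⁺; ∈-allFin; ∈-lookup)
  open import Data.Product.Base using (Σ; _×_; _,_; proj₁; proj₂)
  open import Data.Empty using (⊥-elim)
  open import Relation.Binary.PropositionalEquality hiding ([_])

  module _ {A : Set} where

    lookup-injective : (xs : List A) → Unique xs → ∀ i j → lookup xs i ≡ lookup xs j → i ≡ j
    lookup-injective (x ∷ xs) (x∉ ∷ u) zero    zero    e = refl
    lookup-injective (x ∷ xs) (x∉ ∷ u) zero    (suc j) e = ⊥-elim (All.lookup x∉ (∈-lookup {xs = xs} j) e)
    lookup-injective (x ∷ xs) (x∉ ∷ u) (suc i) zero    e = ⊥-elim (All.lookup x∉ (∈-lookup {xs = xs} i) (sym e))
    lookup-injective (x ∷ xs) (x∉ ∷ u) (suc i) (suc j) e = cong suc (lookup-injective xs u i j e)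

    -- key recovers b from every element of f b, so distinct blocks are disjoint.
    concatMap⁺ : ∀ {B : Set} (f : B → List A) (key : A → B) → (∀ b {x} → x ∈ f b → key x ≡ b) →
      (∀ b → Unique (f b)) → ∀ bs → Unique bs → Unique (concatMap f bs)
    concatMap⁺ f key key-f uf []       u         = []
    concatMap⁺ f key key-f uf (b ∷ bs) (b∉ ∷ u) = ++⁺ (uf b) (concatMap⁺ f key key-f uf bs u) disjoint
      where
      disjoint : ∀ {y} → y ∈ f b × y ∈ concatMap f bs → _
      disjoint (y∈fb , y∈rest) with find (∈-concatMap⁻ f {xs = bs} y∈rest)
      ... | b′ , b′∈bs , y∈fb′ = All.lookup b∉ b′∈bs (trans (sym (key-f b y∈fb)) (key-f b′ y∈fb′))

  module _ {n : ℕ} (G : Graph n) where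

    private
      IsListedEdge : Fin n → Fin n → Set
      IsListedEdge i j = ((toℕ i <ᵇ toℕ j) ∧ G i j) ≡ true

      ∧-true : ∀ {b c} → (b ∧ c) ≡ true → b ≡ true × c ≡ true
      ∧-true {true} {true} _ = refl , refl

      T⇒≡ : ∀ {b} → T b → b ≡ true
      T⇒≡ {true} _ = refl

      entry : Fin n → Fin n → List (Fin n × Fin n)
      entry i j = if (toℕ i <ᵇ toℕ j) ∧ G i j then [ (i , j) ] else []

      row : Fin n → List (Fin n × Fin n)
      row i = concatMap (entry i) (allFin n)

      ∈-entry : ∀ i j {x} → x ∈ entry i j → x ≡ (i , j) × IsListedEdge i j
      ∈-entry i j x∈ with (toℕ i <ᵇ toℕ j) ∧ G i j
      ∈-entry i j (here refl) | true = refl , refl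

      ∈-row : ∀ i {x} → x ∈ row i → proj₁ x ≡ i × IsListedEdge i (proj₂ x)
      ∈-row i x∈ with Any.satisfied (∈-concatMap⁻ (entry i) {xs = allFin n} x∈)
      ... | j , x∈′ with ∈-entry i j x∈′
      ... | refl , c = refl , c

      entry-unique : ∀ i j → Unique (entry i j)
      entry-unique i j with (toℕ i <ᵇ toℕ j) ∧ G i j
      ... | true  = All.[] ∷ []
      ... | false = []

      edges-unique : Unique (edges G)
      edges-unique = concatMap⁺ row proj₁ (λ i x∈ → proj₁ (∈-row i x∈))
        (λ i → concatMap⁺ (entry i) proj₂ (λ j x∈ → cong proj₂ (proj₁ (∈-entry i j x∈))) (entry-unique i) (allFin n) (allFin⁺ n))
        (allFin n) (allFin⁺ n)

      ∈-edges⁻ : ∀ {x} → x ∈ edges G → IsListedEdge (proj₁ x) (proj₂ x)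
      ∈-edges⁻ x∈ with Any.satisfied (∈-concatMap⁻ row {xs = allFin n} x∈)
      ... | i , x∈′ with ∈-row i x∈′
      ... | refl , c = c

      ∈-edges⁺ : ∀ i j → IsListedEdge i j → (i , j) ∈ edges G
      ∈-edges⁺ i j c = ∈-concatMap⁺ row {xs = allFin n} (Any.map (λ { refl → inRow }) (∈-allFin i))
        where
        inEntry : ∀ b → b ≡ true → (i , j) ∈ (if b then [ (i , j) ] else [])
        inEntry true _ = here refl
        inRow : (i , j) ∈ row i
        inRow = ∈-concatMap⁺ (entry i) {xs = allFin n} (Any.map (λ { refl → inEntry _ c }) (∈-allFin j))

    Edge : Set
    Edge = Fin (length (edges G))

    endˡ endʳ : Edge → Fin n
    endˡ k = proj₁ (lookup (edges G) k)
    endʳ k = proj₂ (lookup (edges G) k)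

    private
      edge-isListed : ∀ k → IsListedEdge (endˡ k) (endʳ k)
      edge-isListed k = ∈-edges⁻ (∈-lookup {xs = edges G} k)

    endˡ<endʳ : ∀ k → toℕ (endˡ k) < toℕ (endʳ k)
    endˡ<endʳ k = <ᵇ⇒< _ _ (subst T (sym (proj₁ (∧-true (edge-isListed k)))) _)

    edge-adjacent : ∀ k → G (endˡ k) (endʳ k) ≡ true
    edge-adjacent k = proj₂ (∧-true (edge-isListed k))

    edge-injective : ∀ k l → endˡ k ≡ endˡ l → endʳ k ≡ endʳ l → k ≡ l
    edge-injective k l eˡ eʳ = lookup-injective (edges G) edges-unique k l (cong₂ _,_ eˡ eʳ)

    edge-index : ∀ i j → toℕ i < toℕ j → G i j ≡ true → Σ Edge λ k → endˡ k ≡ i × endʳ k ≡ j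
    edge-index i j i<j ij = Any.index p , cong proj₁ (sym (lookup-index p)) , cong proj₂ (sym (lookup-index p))
      where p = ∈-edges⁺ i j (cong₂ _∧_ (T⇒≡ (<⇒<ᵇ i<j)) ij)

module NaturalWeights where

  open import Defs using (Graph; Subset; IsMaximalStable; IsEquistable; weight)
  open import Data.Nat.Base as ℕ using (ℕ; zero; suc)
  import Data.Nat.Properties as ℕ
  open import Data.Rational using (ℚ; 0ℚ; 1ℚ; _<_; _≤_; _+_; _*_; 1/_; Positive; NonZero; positive)
  open import Data.Rational.Properties
  open import Data.Fin.Base using (Fin)
  open import Data.Bool.Base using (true; false; if_then_else_)
  open import Data.List.Base using ([]; _∷_; foldr; allFin)
  open import Data.Product.Base using (_×_; _,_; proj₁; proj₂)
  open import Data.Empty using (⊥-elim)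
  open import Relation.Binary.PropositionalEquality
  open import Relation.Binary.Definitions using (tri<; tri≈; tri>)

  fromℕ : ℕ → ℚ
  fromℕ zero    = 0ℚ
  fromℕ (suc k) = 1ℚ + fromℕ k

  fromℕ-+ : ∀ a b → fromℕ (a ℕ.+ b) ≡ fromℕ a + fromℕ b
  fromℕ-+ zero    b = sym (+-identityˡ (fromℕ b))
  fromℕ-+ (suc a) b = trans (cong (1ℚ +_) (fromℕ-+ a b)) (sym (+-assoc 1ℚ (fromℕ a) (fromℕ b)))

  fromℕ-mono-< : ∀ {a b} → a ℕ.< b → fromℕ a < fromℕ b
  fromℕ-mono-< {zero}  {suc b} _ = ≤-<-trans (nonNeg b) (≤-<-trans (≤-reflexive (sym (+-identityˡ _))) (+-monoˡ-< (fromℕ b) (positive⁻¹ 1ℚ)))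
    where
    nonNeg : ∀ k → 0ℚ ≤ fromℕ k
    nonNeg zero    = ≤-refl
    nonNeg (suc k) = ≤-trans (nonNeg k) (≤-trans (≤-reflexive (sym (+-identityˡ (fromℕ k)))) (+-monoˡ-≤ (fromℕ k) (<⇒≤ (positive⁻¹ 1ℚ))))
  fromℕ-mono-< {suc a} {suc b} (ℕ.s≤s a<b) = +-monoʳ-< 1ℚ (fromℕ-mono-< a<b)

  fromℕ-injective : ∀ a b → fromℕ a ≡ fromℕ b → a ≡ b
  fromℕ-injective a b e with ℕ.<-cmp a b
  ... | tri≈ _ a≡b _ = a≡b
  ... | tri< a<b _ _ = ⊥-elim (<-irrefl e (fromℕ-mono-< a<b))
  ... | tri> _ _ b<a = ⊥-elim (<-irrefl (sym e) (fromℕ-mono-< b<a))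

  weightℕ : ∀ {m} → (Fin m → ℕ) → Subset m → ℕ
  weightℕ {m} w S = foldr (λ v acc → (if S v then w v else 0) ℕ.+ acc) 0 (allFin m)

  module Scaling (D : ℕ) where

    private
      D′ : ℚ
      D′ = fromℕ (suc D)

      instance
        D′>0 : Positive D′
        D′>0 = positive (fromℕ-mono-< {0} {suc D} (ℕ.s≤s ℕ.z≤n))

        D′≢0 : NonZero D′
        D′≢0 = pos⇒nonZero D′

    scale : ℕ → ℚ
    scale k = fromℕ k * 1/ D′

    scale-positive : ∀ {k} → 0 ℕ.< k → 0ℚ < scale k
    scale-positive {k} k>0 = positive⁻¹ _ {{pos*pos⇒pos (fromℕ k) {{positive (fromℕ-mono-< k>0)}} (1/ D′) {{1/pos⇒pos D′}}}}

    scale-suc-D : scale (suc D) ≡ 1ℚ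
    scale-suc-D = *-inverseʳ D′

    scale-injective : ∀ a b → scale a ≡ scale b → a ≡ b
    scale-injective a b e = fromℕ-injective a b (trans (sym (unscale a)) (trans (cong (_* D′) e) (unscale b)))
      where
      unscale : ∀ x → scale x * D′ ≡ fromℕ x
      unscale x = trans (*-assoc (fromℕ x) (1/ D′) D′) (trans (cong (fromℕ x *_) (*-inverseˡ D′)) (*-identityʳ (fromℕ x)))

    weight-scale : ∀ {m} (w : Fin m → ℕ) S → weight (λ v → scale (w v)) S ≡ scale (weightℕ w S)
    weight-scale {m} w S = go (allFin m)
      where
      go : ∀ vs → foldr (λ v acc → (if S v then scale (w v) else 0ℚ) + acc) 0ℚ vs
                ≡ scale (foldr (λ v acc → (if S v then w v else 0) ℕ.+ acc) 0 vs)
      go []       = sym (*-zeroˡ (1/ D′))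
      go (v ∷ vs) = trans (cong₂ _+_ (term (S v)) (go vs))
        (trans (sym (*-distribʳ-+ (1/ D′) (fromℕ (if S v then w v else 0)) _)) (cong (_* 1/ D′) (sym (fromℕ-+ (if S v then w v else 0) _))))
        where
        term : ∀ b → (if b then scale (w v) else 0ℚ) ≡ scale (if b then w v else 0)
        term true  = refl
        term false = sym (*-zeroˡ (1/ D′))

  equistable-byℕ : ∀ {m} (H : Graph m) (w : Fin m → ℕ) (D : ℕ) →
    (∀ v → 0 ℕ.< w v) →
    (∀ S → (IsMaximalStable H S → weightℕ w S ≡ suc D) × (weightℕ w S ≡ suc D → IsMaximalStable H S)) →
    IsEquistable H
  equistable-byℕ H w D w>0 maximal⇔D = (λ v → scale (w v)) , (λ v → scale-positive (w>0 v)) , λ S →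
    (λ mx → trans (weight-scale w S) (trans (cong scale (proj₁ (maximal⇔D S) mx)) scale-suc-D)) ,
    (λ w≡1 → proj₂ (maximal⇔D S) (scale-injective _ _ (trans (sym (weight-scale w S)) (trans w≡1 (sym scale-suc-D)))))
    where open Scaling D

module LineGraphComplement {n : ℕ} (G : Graph n) (simple : IsSimple G) where

  open EdgeEnumeration
  open Parity
  open IntegerSums
  open import Data.Integer.Base as ℤ using (+_)
  import Data.Integer.Properties as ℤ
  open import Data.Nat.Base as ℕ using (_<_)
  open import Data.Nat.Properties using (<-cmp; <-irrefl; <-asym)
  open import Data.Fin.Base using (Fin; toℕ)
  open import Data.Fin.Properties using (toℕ-injective; any?) renaming (_≟_ to _≟ᶠ_)
  open import Data.Bool.Base using (Bool; true; false; not; _∧_; _∨_)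
  import Data.Bool.Properties as Bool
  open import Data.List.Base using (length)
  open import Data.Product.Base using (Σ; _×_; _,_; proj₁; proj₂)
  open import Data.Sum.Base using (_⊎_; inj₁; inj₂)
  open import Data.Empty using (⊥-elim)
  open import Relation.Nullary using (¬_; yes; no)
  open import Relation.Binary.PropositionalEquality
  open import Relation.Binary.Definitions using (tri<; tri≈; tri>)

  H : Graph (length (edges G))
  H = complement (lineGraph G)

  _∈ₑ_ : Fin n → Edge G → Set
  x ∈ₑ k = endˡ G k ≡ x ⊎ endʳ G k ≡ x

  ShareEnd : Edge G → Edge G → Set
  ShareEnd k l = Σ (Fin n) λ x → x ∈ₑ k × x ∈ₑ l

  star : Fin n → Subset (length (edges G))
  star x k = (endˡ G k ==ᶠ x) ∨ (endʳ G k ==ᶠ x)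

  private
    ==ᶠ⇒≡ : ∀ {x y : Fin n} → (x ==ᶠ y) ≡ true → x ≡ y
    ==ᶠ⇒≡ {x} {y} e with x ≟ᶠ y
    ... | yes x≡y = x≡y

    ≡⇒==ᶠ : ∀ {x y : Fin n} → x ≡ y → (x ==ᶠ y) ≡ true
    ≡⇒==ᶠ {x} {y} x≡y with x ≟ᶠ y
    ... | yes _   = refl
    ... | no  x≢y = ⊥-elim (x≢y x≡y)

    ∨-true : ∀ {a b} → (a ∨ b) ≡ true → a ≡ true ⊎ b ≡ true
    ∨-true {true}  _ = inj₁ refl
    ∨-true {false} e = inj₂ e

    ∨-introˡ : ∀ a b → a ≡ true → (a ∨ b) ≡ true
    ∨-introˡ true b _ = refl

    ∨-introʳ : ∀ a b → b ≡ true → (a ∨ b) ≡ true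
    ∨-introʳ true  b _ = refl
    ∨-introʳ false b e = e

    true≢false : true ≢ false
    true≢false ()

  star⇒∈ₑ : ∀ x k → star x k ≡ true → x ∈ₑ k
  star⇒∈ₑ x k e with ∨-true {endˡ G k ==ᶠ x} e
  ... | inj₁ a = inj₁ (==ᶠ⇒≡ a)
  ... | inj₂ b = inj₂ (==ᶠ⇒≡ b)

  ∈ₑ⇒star : ∀ x k → x ∈ₑ k → star x k ≡ true
  ∈ₑ⇒star x k (inj₁ a) = ∨-introˡ _ _ (≡⇒==ᶠ a)
  ∈ₑ⇒star x k (inj₂ b) = ∨-introʳ (endˡ G k ==ᶠ x) _ (≡⇒==ᶠ b)

  ∉star⇒∉ₑ : ∀ x k → star x k ≡ false → ¬ x ∈ₑ k
  ∉star⇒∉ₑ x k e x∈k = true≢false (trans (sym (∈ₑ⇒star x k x∈k)) e)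

  -- the Boolean test inside Defs.lineGraph, so that H k l computes by cases on k ≟ l and shareEnd? k l
  shareEnd? : Edge G → Edge G → Bool
  shareEnd? k l = (endˡ G k ==ᶠ endˡ G l) ∨ (endˡ G k ==ᶠ endʳ G l) ∨ (endʳ G k ==ᶠ endˡ G l) ∨ (endʳ G k ==ᶠ endʳ G l)

  shareEnd?⇒ShareEnd : ∀ k l → shareEnd? k l ≡ true → ShareEnd k l
  shareEnd?⇒ShareEnd k l e with ∨-true {endˡ G k ==ᶠ endˡ G l} e
  ... | inj₁ x = endˡ G k , inj₁ refl , inj₁ (sym (==ᶠ⇒≡ x))
  ... | inj₂ e₂ with ∨-true {endˡ G k ==ᶠ endʳ G l} e₂
  ... | inj₁ x = endˡ G k , inj₁ refl , inj₂ (sym (==ᶠ⇒≡ x))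
  ... | inj₂ e₃ with ∨-true {endʳ G k ==ᶠ endˡ G l} e₃
  ... | inj₁ x = endʳ G k , inj₂ refl , inj₁ (sym (==ᶠ⇒≡ x))
  ... | inj₂ x = endʳ G k , inj₂ refl , inj₂ (sym (==ᶠ⇒≡ x))

  ShareEnd⇒shareEnd? : ∀ k l → ShareEnd k l → shareEnd? k l ≡ true
  ShareEnd⇒shareEnd? k l (x , inj₁ a , inj₁ b) = ∨-introˡ _ _ (≡⇒==ᶠ (trans a (sym b)))
  ShareEnd⇒shareEnd? k l (x , inj₁ a , inj₂ b) = ∨-introʳ (endˡ G k ==ᶠ endˡ G l) _ (∨-introˡ _ _ (≡⇒==ᶠ (trans a (sym b))))
  ShareEnd⇒shareEnd? k l (x , inj₂ a , inj₁ b) = ∨-introʳ (endˡ G k ==ᶠ endˡ G l) _ (∨-introʳ (endˡ G k ==ᶠ endʳ G l) _ (∨-introˡ _ _ (≡⇒==ᶠ (trans a (sym b)))))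
  ShareEnd⇒shareEnd? k l (x , inj₂ a , inj₂ b) = ∨-introʳ (endˡ G k ==ᶠ endˡ G l) _ (∨-introʳ (endˡ G k ==ᶠ endʳ G l) _ (∨-introʳ (endʳ G k ==ᶠ endˡ G l) _ (≡⇒==ᶠ (trans a (sym b)))))

  H≡true⇒ : ∀ k l → H k l ≡ true → k ≢ l × ¬ ShareEnd k l
  H≡true⇒ k l e with k ≟ᶠ l | shareEnd? k l in s
  ... | no k≢l | false = k≢l , λ sh → true≢false (trans (sym (ShareEnd⇒shareEnd? k l sh)) s)
  H≡true⇒ k l () | no _  | true
  H≡true⇒ k l () | yes _ | _

  H≡false⇒ : ∀ k l → H k l ≡ false → k ≡ l ⊎ ShareEnd k l
  H≡false⇒ k l e with k ≟ᶠ l | shareEnd? k l in s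
  ... | yes k≡l | _    = inj₁ k≡l
  ... | no _    | true = inj₂ (shareEnd?⇒ShareEnd k l s)
  H≡false⇒ k l () | no _ | false

  H≡true : ∀ k l → k ≢ l → shareEnd? k l ≡ false → H k l ≡ true
  H≡true k l k≢l s with k ≟ᶠ l
  ... | yes k≡l = ⊥-elim (k≢l k≡l)
  ... | no _ rewrite s = refl

  H≡false : ∀ k l → ShareEnd k l → H k l ≡ false
  H≡false k l sh with k ≟ᶠ l
  ... | yes _ = refl
  ... | no _ rewrite ShareEnd⇒shareEnd? k l sh = refl

  edge-between : ∀ i j → G i j ≡ true →
    Σ (Edge G) λ k → (endˡ G k ≡ i × endʳ G k ≡ j) ⊎ (endˡ G k ≡ j × endʳ G k ≡ i)
  edge-between i j ij with <-cmp (toℕ i) (toℕ j)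
  ... | tri< i<j _ _ with k , eˡ , eʳ ← edge-index G i j i<j ij = k , inj₁ (eˡ , eʳ)
  ... | tri> _ _ j<i with k , eˡ , eʳ ← edge-index G j i j<i (trans (proj₁ simple j i) ij) = k , inj₂ (eˡ , eʳ)
  edge-between i j ij | tri≈ _ i≡j _ with () ← trans (sym ij) (trans (cong (G i) (sym (toℕ-injective i≡j))) (proj₂ simple i))

  edge-unordered-injective : ∀ k l → (endˡ G k ≡ endˡ G l × endʳ G k ≡ endʳ G l) ⊎ (endˡ G k ≡ endʳ G l × endʳ G k ≡ endˡ G l) → k ≡ l
  edge-unordered-injective k l (inj₁ (eˡ , eʳ)) = edge-injective G k l eˡ eʳ
  edge-unordered-injective k l (inj₂ (eˡ , eʳ)) = ⊥-elim (<-asym (subst₂ _<_ (cong toℕ eˡ) (cong toℕ eʳ) (endˡ<endʳ G k)) (endˡ<endʳ G l))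

  ends-adjacent : ∀ k y z → y ∈ₑ k → z ∈ₑ k → y ≢ z → G y z ≡ true
  ends-adjacent k y z (inj₁ refl) (inj₁ refl) y≢z = ⊥-elim (y≢z refl)
  ends-adjacent k y z (inj₁ refl) (inj₂ refl) y≢z = edge-adjacent G k
  ends-adjacent k y z (inj₂ refl) (inj₁ refl) y≢z = trans (proj₁ simple (endʳ G k) (endˡ G k)) (edge-adjacent G k)
  ends-adjacent k y z (inj₂ refl) (inj₂ refl) y≢z = ⊥-elim (y≢z refl)

  endˡ≢endʳ : ∀ k → endˡ G k ≢ endʳ G k
  endˡ≢endʳ k e = <-irrefl (cong toℕ e) (endˡ<endʳ G k)

  isMaximalStable-≗ : ∀ S S′ → (∀ k → S k ≡ S′ k) → IsMaximalStable H S → IsMaximalStable H S′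
  isMaximalStable-≗ S S′ S≗S′ (stable , maximal) =
    (λ x y sx sy → stable x y (trans (S≗S′ x) sx) (trans (S≗S′ y) sy)) ,
    (λ v sv → let (u , su , huv) = maximal v (trans (S≗S′ v) sv) in u , trans (sym (S≗S′ u)) su , huv)

  stable⇒ShareEnd : ∀ {S} → IsStable H S → ∀ k l → S k ≡ true → S l ≡ true → k ≢ l → ShareEnd k l
  stable⇒ShareEnd stable k l sk sl k≢l with H≡false⇒ k l (stable k l sk sl)
  ... | inj₁ k≡l = ⊥-elim (k≢l k≡l)
  ... | inj₂ sh  = sh

  star-isStable : ∀ x → IsStable H (star x)
  star-isStable x k l sk sl = H≡false k l (x , star⇒∈ₑ x k sk , star⇒∈ₑ x l sl)

  module _ (triangle-free : TriangleFree G) where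

    private
      other-end : ∀ {k x y z} → (endˡ G k ≡ x × endʳ G k ≡ y) ⊎ (endˡ G k ≡ y × endʳ G k ≡ x) → z ∈ₑ k → z ≢ x → z ≡ y
      other-end (inj₁ (refl , _)) (inj₁ refl) z≢x = ⊥-elim (z≢x refl)
      other-end (inj₁ (_ , refl)) (inj₂ refl) z≢x = refl
      other-end (inj₂ (refl , _)) (inj₁ refl) z≢x = refl
      other-end (inj₂ (_ , refl)) (inj₂ refl) z≢x = ⊥-elim (z≢x refl)

      first-end : ∀ {k x y} → (endˡ G k ≡ x × endʳ G k ≡ y) ⊎ (endˡ G k ≡ y × endʳ G k ≡ x) → x ∈ₑ k
      first-end (inj₁ (eˡ , _)) = inj₁ eˡ
      first-end (inj₂ (_ , eʳ)) = inj₂ eʳ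

    -- An edge k avoiding x but meeting both x y₁ and x y₂ would close the triangle x y₁ y₂.
    star-isMaximalStable : ∀ x y₁ y₂ → G x y₁ ≡ true → G x y₂ ≡ true → y₁ ≢ y₂ → IsMaximalStable H (star x)
    star-isMaximalStable x y₁ y₂ xy₁ xy₂ y₁≢y₂ = star-isStable x , maximal
      where
      u₁ = proj₁ (edge-between x y₁ xy₁)
      u₂ = proj₁ (edge-between x y₂ xy₂)
      u₁-ends = proj₂ (edge-between x y₁ xy₁)
      u₂-ends = proj₂ (edge-between x y₂ xy₂)
      x∈u₁ = ∈ₑ⇒star x u₁ (first-end u₁-ends)
      x∈u₂ = ∈ₑ⇒star x u₂ (first-end u₂-ends)
      maximal : ∀ k → star x k ≡ false → Σ _ λ u → star x u ≡ true × H u k ≡ true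
      maximal k x∉k with shareEnd? u₁ k in s₁ | shareEnd? u₂ k in s₂
      ... | false | _     = u₁ , x∈u₁ , H≡true u₁ k (λ { refl → true≢false (trans (sym x∈u₁) x∉k) }) s₁
      ... | true  | false = u₂ , x∈u₂ , H≡true u₂ k (λ { refl → true≢false (trans (sym x∈u₂) x∉k) }) s₂
      ... | true  | true  = ⊥-elim (triangle-free (x , y₁ , y₂ , xy₁ , y₁y₂ , xy₂))
        where
        meet-at-other-end : ∀ {u y} → (endˡ G u ≡ x × endʳ G u ≡ y) ⊎ (endˡ G u ≡ y × endʳ G u ≡ x) → shareEnd? u k ≡ true → y ∈ₑ k
        meet-at-other-end ends s with z , z∈u , z∈k ← shareEnd?⇒ShareEnd _ k s =
          subst (_∈ₑ k) (other-end ends z∈u (λ { refl → ∉star⇒∉ₑ x k x∉k z∈k })) z∈k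
        y₁y₂ : G y₁ y₂ ≡ true
        y₁y₂ = ends-adjacent k y₁ y₂ (meet-at-other-end u₁-ends s₁) (meet-at-other-end u₂-ends s₂) y₁≢y₂

    private
      maximalStable-inhabited : Edge G → ∀ S → IsMaximalStable H S → Σ (Edge G) λ u → S u ≡ true
      maximalStable-inhabited k S (_ , maximal) with S k in sk
      ... | true  = k , sk
      ... | false = let (u , su , _) = maximal k sk in u , su

      ⊆star⇒≗star : ∀ S x → IsMaximalStable H S → (∀ k → S k ≡ true → star x k ≡ true) → ∀ k → S k ≡ star x k
      ⊆star⇒≗star S x (_ , maximal) S⊆star k with S k in sk
      ... | true = sym (S⊆star k sk)
      ... | false with star x k in x∈k
      ...   | false = refl
      ...   | true with u , su , huk ← maximal k sk =
        ⊥-elim (proj₂ (H≡true⇒ u k huk) (x , star⇒∈ₑ x u (S⊆star u su) , star⇒∈ₑ x k x∈k))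

      -- If some member k₁ of S avoids the end i of u₀ ∈ S, then a member k avoiding j
      -- would give a triangle i j z, where z is the common end of k and k₁.
      ⊆star-other-end : ∀ S → IsStable H S → ∀ u₀ k₁ → S u₀ ≡ true → S k₁ ≡ true → star (endˡ G u₀) k₁ ≡ false →
        ∀ k → S k ≡ true → star (endʳ G u₀) k ≡ true
      ⊆star-other-end S stable u₀ k₁ su₀ sk₁ i∉k₁ k sk with star j k in j∉k
        where j = endʳ G u₀
      ... | true  = refl
      ... | false = ⊥-elim (triangle-free (i , j , z , edge-adjacent G u₀ , ends-adjacent k₁ j z j∈k₁ z∈k₁ j≢z , ends-adjacent k i z i∈k z∈k i≢z))
        where
        i = endˡ G u₀
        j = endʳ G u₀
        meets-u₀ : ∀ l → S l ≡ true → l ≢ u₀ → i ∈ₑ l ⊎ j ∈ₑ l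
        meets-u₀ l sl l≢u₀ with y , y∈l , y∈u₀ ← stable⇒ShareEnd stable l u₀ sl su₀ l≢u₀ with y∈u₀
        ... | inj₁ refl = inj₁ y∈l
        ... | inj₂ refl = inj₂ y∈l
        j∈k₁ : j ∈ₑ k₁
        j∈k₁ with meets-u₀ k₁ sk₁ (λ { refl → ∉star⇒∉ₑ i u₀ i∉k₁ (inj₁ refl) })
        ... | inj₁ i∈k₁ = ⊥-elim (∉star⇒∉ₑ i k₁ i∉k₁ i∈k₁)
        ... | inj₂ j∈k₁ = j∈k₁
        i∈k : i ∈ₑ k
        i∈k with meets-u₀ k sk (λ { refl → ∉star⇒∉ₑ j u₀ j∉k (inj₂ refl) })
        ... | inj₁ i∈k = i∈k
        ... | inj₂ j∈k = ⊥-elim (∉star⇒∉ₑ j k j∉k j∈k)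
        k-k₁ : ShareEnd k k₁
        k-k₁ = stable⇒ShareEnd stable k k₁ sk sk₁ (λ { refl → ∉star⇒∉ₑ i k i∉k₁ i∈k })
        z = proj₁ k-k₁
        z∈k = proj₁ (proj₂ k-k₁)
        z∈k₁ = proj₂ (proj₂ k-k₁)
        i≢z : i ≢ z
        i≢z i≡z = ∉star⇒∉ₑ i k₁ i∉k₁ (subst (_∈ₑ k₁) (sym i≡z) z∈k₁)
        j≢z : j ≢ z
        j≢z j≡z = ∉star⇒∉ₑ j k j∉k (subst (_∈ₑ k) (sym j≡z) z∈k)

    maximalStable⇒star : Edge G → ∀ S → IsMaximalStable H S → Σ (Fin n) λ x → ∀ k → S k ≡ star x k
    maximalStable⇒star k₀ S mx@(stable , _) with u₀ , su₀ ← maximalStable-inhabited k₀ S mx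
      with any? (λ k → (S k ∧ not (star (endˡ G u₀) k)) Bool.≟ true)
    ... | no none = endˡ G u₀ , ⊆star⇒≗star S (endˡ G u₀) mx S⊆star
      where
      S⊆star : ∀ k → S k ≡ true → star (endˡ G u₀) k ≡ true
      S⊆star k sk with star (endˡ G u₀) k in e
      ... | true  = refl
      ... | false = ⊥-elim (none (k , cong₂ (λ a b → a ∧ not b) sk e))
    ... | yes (k₁ , e) = endʳ G u₀ , ⊆star⇒≗star S (endʳ G u₀) mx
      (⊆star-other-end S stable u₀ k₁ su₀ (∧-trueˡ e) (not-true (∧-trueʳ e)))
      where
      ∧-trueˡ : ∀ {a b} → (a ∧ b) ≡ true → a ≡ true
      ∧-trueˡ {true} _ = refl
      ∧-trueʳ : ∀ {a b} → (a ∧ b) ≡ true → b ≡ true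
      ∧-trueʳ {true} e = e
      not-true : ∀ {b} → not b ≡ true → b ≡ false
      not-true {false} _ = refl

  ∑-star≡2 : ∀ k → ∑[ x < n ] when (star x k) (+ 1) ≡ + 2
  ∑-star≡2 k = trans (sum-pair (λ x → when (star x k) (+ 1)) (endˡ G k) (endʳ G k) (endˡ≢endʳ k) others)
    (cong₂ (λ a b → when a (+ 1) ℤ.+ when b (+ 1)) (∈ₑ⇒star _ k (inj₁ refl)) (∈ₑ⇒star _ k (inj₂ refl)))
    where
    others : ∀ x → x ≢ endˡ G k → x ≢ endʳ G k → when (star x k) (+ 1) ≡ + 0
    others x x≢ˡ x≢ʳ with star x k in x∈k
    ... | false = refl
    ... | true with star⇒∈ₑ x k x∈k
    ...   | inj₁ eˡ = ⊥-elim (x≢ˡ (sym eˡ))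
    ...   | inj₂ eʳ = ⊥-elim (x≢ʳ (sym eʳ))

  -- A strong clique of H is a perfect matching of G: double counting pairs (x , k) with
  -- x an end of the clique edge k gives n = 2 * count C.
  odd⇒¬strongClique : odd? n ≡ true → (∀ x → IsMaximalStable H (star x)) → ¬ Σ (Subset _) (IsStrongClique H)
  odd⇒¬strongClique n-odd star-maximal (C , clique , meets) = true≢false parity-clash
    where
    open ≡-Reasoning
    pairs : Fin n → Edge G → ℤ.ℤ
    pairs x k = when (C k ∧ star x k) (+ 1)

    one-per-vertex : ∀ x → ∑[ k < _ ] pairs x k ≡ + 1
    one-per-vertex x with k , ck , x∈k ← meets (star x) (star-maximal x) =
      trans (sum-single (pairs x) k others) (cong (λ b → when b (+ 1)) (cong₂ _∧_ ck x∈k))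
      where
      others : ∀ l → l ≢ k → pairs x l ≡ + 0
      others l l≢k with C l in cl | star x l in x∈l
      ... | false | _     = refl
      ... | true  | false = refl
      ... | true  | true  = ⊥-elim (proj₂ (H≡true⇒ l k (clique l k l≢k cl ck)) (x , star⇒∈ₑ x l x∈l , star⇒∈ₑ x k x∈k))

    n≡2*count : + n ≡ + (2 ℕ.* count C)
    n≡2*count = begin
      + n                                        ≡⟨ sum-const1 n ⟨
      ∑[ x < n ] (+ 1)                           ≡⟨ sum-cong-≗ one-per-vertex ⟨
      ∑[ x < n ] (∑[ k < _ ] pairs x k)          ≡⟨ ∑-comm pairs ⟩
      ∑[ k < _ ] (∑[ x < n ] pairs x k)          ≡⟨ sum-cong-≗ per-edge ⟩
      ∑[ k < _ ] (+ 2 ℤ.* when (C k) (+ 1))      ≡⟨ sum-*ˡ (+ 2) (λ k → when (C k) (+ 1)) ⟩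
      + 2 ℤ.* (∑[ k < _ ] when (C k) (+ 1))      ≡⟨ cong (+ 2 ℤ.*_) (sum-when1≡count C) ⟩
      + 2 ℤ.* + count C                          ≡⟨ ℤ.pos-* 2 (count C) ⟨
      + (2 ℕ.* count C)                          ∎
      where
      per-edge : ∀ k → ∑[ x < n ] pairs x k ≡ + 2 ℤ.* when (C k) (+ 1)
      per-edge k = begin
        ∑[ x < n ] when (C k ∧ star x k) (+ 1)          ≡⟨ sum-cong-≗ (λ x → when-∧ (C k) (star x k) (+ 1)) ⟨
        ∑[ x < n ] when (C k) (when (star x k) (+ 1))   ≡⟨ when-sum (C k) (λ x → when (star x k) (+ 1)) ⟨
        when (C k) (∑[ x < n ] when (star x k) (+ 1))   ≡⟨ cong (when (C k)) (∑-star≡2 k) ⟩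
        when (C k) (+ 2)                                ≡⟨ when≡when1* (C k) (+ 2) ⟩
        when (C k) (+ 1) ℤ.* + 2                        ≡⟨ ℤ.*-comm (when (C k) (+ 1)) (+ 2) ⟩
        + 2 ℤ.* when (C k) (+ 1)                        ∎

    parity-clash : true ≡ false
    parity-clash = trans (sym n-odd) (trans (cong odd? (ℤ.+-injective n≡2*count)) (odd?-2* (count C)))

module GeneralPartition where

  open import Defs using (Graph; Subset; IsClique; IsStrongClique; IsMaximalStable; IsGeneralPartition)
  open import Data.Nat.Base using (zero; suc)
  open import Data.Fin.Base using (Fin; zero; suc)
  open import Data.Bool.Base using (true)
  open import Data.Product.Base using (Σ; _×_; _,_; proj₁; proj₂)
  open import Data.Empty using (⊥-elim)
  open import Relation.Nullary using (¬_; Dec; yes; no; does)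
  open import Relation.Nullary.Decidable using (¬¬-excluded-middle)
  open import Relation.Binary.PropositionalEquality using (_≡_; refl)

  ¬¬-decidable : ∀ {m} (P : Fin m → Set) → ¬ ¬ (∀ x → Dec (P x))
  ¬¬-decidable {zero}  P k = k (λ ())
  ¬¬-decidable {suc m} P k = ¬¬-decidable (λ x → P (suc x)) λ dec-suc →
    ¬¬-excluded-middle λ dec-zero → k λ { zero → dec-zero ; (suc x) → dec-suc x }

  -- Constructively only the double negation survives: membership u ∈ U_x need not be decidable.
  generalPartition⇒¬¬strongClique : ∀ {m} (H : Graph m) → Fin m → IsGeneralPartition H →
    ¬ ¬ Σ (Subset m) (IsStrongClique H)
  generalPartition⇒¬¬strongClique H v (U , Mem , nonempty , adjacency , partition) no-clique =
    ¬¬-decidable (λ x → Mem x u) λ dec → no-clique (clique-at u dec)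
    where
    u = proj₁ (nonempty v)
    clique-at : ∀ u → (∀ x → Dec (Mem x u)) → Σ _ (IsStrongClique H)
    clique-at u dec = C , clique , meets
      where
      C : Subset _
      C x = does (dec x)
      C⇒Mem : ∀ x → C x ≡ true → Mem x u
      C⇒Mem x _ with dec x
      ... | yes p = p
      Mem⇒C : ∀ x → Mem x u → C x ≡ true
      Mem⇒C x p with dec x
      ... | yes _ = refl
      ... | no ¬p = ⊥-elim (¬p p)
      clique : IsClique H C
      clique x y x≢y cx cy = proj₂ (adjacency x y x≢y) (u , C⇒Mem x cx , C⇒Mem y cy)
      meets : ∀ S → IsMaximalStable H S → Σ _ λ x → C x ≡ true × S x ≡ true
      meets S mx with (x , sx , x∈u) , _ ← partition S mx u = x , Mem⇒C x x∈u , sx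

module CyclePositions {m : ℕ} (G : Graph (suc m)) (simple : IsSimple G)
  (σ : Fin (suc m) → Fin (suc m)) (σ-injective : Injective _≡_ _≡_ σ)
  (cycle : ∀ p → G (σ p) (σ (CyclicDistance.next m p)) ≡ true) (2≤m : 2 ℕ.≤ m) where

  open EdgeEnumeration
  open LineGraphComplement G simple using (edge-between; edge-unordered-injective)
  open import Data.Fin.Base using (toℕ)
  open import Data.Fin.Properties using () renaming (_≟_ to _≟ᶠ_)
  open import Data.Bool.Base using (Bool)
  open import Data.Maybe.Base using (Maybe; just; nothing; is-just)
  open import Data.Product.Base using (Σ; _×_; _,_; proj₁; proj₂)
  open import Data.Sum.Base using (_⊎_; inj₁; inj₂)
  open import Data.Empty using (⊥-elim)
  open import Relation.Nullary using (yes; no)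
  open import Relation.Binary.PropositionalEquality

  n : ℕ
  n = suc m

  open FinSurjection
  open CyclicDistance m using (next; next-injective)
  open CyclicDistance.Order≥3 m 2≤m using (next²≢)

  -- opaque: both inverses come from an exhaustive search over Fin n that should never be unfolded
  opaque
    prev : Fin n → Fin n
    prev v = proj₁ (injective⇒surjective next (λ {p} {q} → next-injective p q) v)

    next-prev : ∀ v → next (prev v) ≡ v
    next-prev v = proj₂ (injective⇒surjective next (λ {p} {q} → next-injective p q) v)

    σ⁻¹ : Fin n → Fin n
    σ⁻¹ i = proj₁ (injective⇒surjective σ σ-injective i)

    σ-σ⁻¹ : ∀ i → σ (σ⁻¹ i) ≡ i
    σ-σ⁻¹ i = proj₂ (injective⇒surjective σ σ-injective i)

  σ⁻¹-σ : ∀ p → σ⁻¹ (σ p) ≡ p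
  σ⁻¹-σ p = σ-injective (σ-σ⁻¹ (σ p))

  posˡ posʳ : Edge G → Fin n
  posˡ k = σ⁻¹ (endˡ G k)
  posʳ k = σ⁻¹ (endʳ G k)

  σ-posˡ : ∀ k → σ (posˡ k) ≡ endˡ G k
  σ-posˡ k = σ-σ⁻¹ (endˡ G k)

  σ-posʳ : ∀ k → σ (posʳ k) ≡ endʳ G k
  σ-posʳ k = σ-σ⁻¹ (endʳ G k)

  posˡ≢posʳ : ∀ k → posˡ k ≢ posʳ k
  posˡ≢posʳ k e = <-irrefl (cong toℕ (trans (sym (σ-posˡ k)) (trans (cong σ e) (σ-posʳ k)))) (endˡ<endʳ G k)
    where open import Data.Nat.Properties using (<-irrefl)

  -- just a when {p , q} = {a , next a}, i.e. when p q is the cycle edge at position a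
  cycleStart : Fin n → Fin n → Maybe (Fin n)
  cycleStart p q with next p ≟ᶠ q
  ... | yes _ = just p
  ... | no _ with next q ≟ᶠ p
  ...   | yes _ = just q
  ...   | no _  = nothing

  cycleStart-just : ∀ p q a → cycleStart p q ≡ just a → (p ≡ a × q ≡ next a) ⊎ (q ≡ a × p ≡ next a)
  cycleStart-just p q a e with next p ≟ᶠ q
  cycleStart-just p q a refl | yes pq = inj₁ (refl , sym pq)
  ... | no _ with next q ≟ᶠ p
  cycleStart-just p q a refl | no _ | yes qp = inj₂ (refl , sym qp)
  cycleStart-just p q a ()   | no _ | no _

  cycleStart-forward : ∀ p q → q ≡ next p → cycleStart p q ≡ just p
  cycleStart-forward p q e with next p ≟ᶠ q
  ... | yes _  = refl
  ... | no ¬pq = ⊥-elim (¬pq (sym e))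

  cycleStart-backward : ∀ p q → p ≡ next q → cycleStart p q ≡ just q
  cycleStart-backward p q e with next p ≟ᶠ q
  ... | yes pq = ⊥-elim (next²≢ q (trans (cong next (sym e)) pq))
  ... | no _ with next q ≟ᶠ p
  ...   | yes _  = refl
  ...   | no ¬qp = ⊥-elim (¬qp (sym e))

  cycleStart-chord : ∀ p q → next p ≢ q → next q ≢ p → cycleStart p q ≡ nothing
  cycleStart-chord p q ¬pq ¬qp with next p ≟ᶠ q
  ... | yes pq = ⊥-elim (¬pq pq)
  ... | no _ with next q ≟ᶠ p
  ...   | yes qp = ⊥-elim (¬qp qp)
  ...   | no _   = refl

  cyclePos : Edge G → Maybe (Fin n)
  cyclePos k = cycleStart (posˡ k) (posʳ k)

  isCycleEdge : Edge G → Bool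
  isCycleEdge k = is-just (cyclePos k)

  private
    σ⁻¹-of : ∀ {x p} → x ≡ σ p → σ⁻¹ x ≡ p
    σ⁻¹-of refl = σ⁻¹-σ _

    cycleEdge : ∀ a → Σ (Edge G) λ k → cyclePos k ≡ just a
    cycleEdge a with edge-between (σ a) (σ (next a)) (cycle a)
    ... | k , inj₁ (eˡ , eʳ) = k , trans (cycleStart-forward (posˡ k) (posʳ k) (trans (σ⁻¹-of eʳ) (cong next (sym (σ⁻¹-of eˡ))))) (cong just (σ⁻¹-of eˡ))
    ... | k , inj₂ (eˡ , eʳ) = k , trans (cycleStart-backward (posˡ k) (posʳ k) (trans (σ⁻¹-of eˡ) (cong next (sym (σ⁻¹-of eʳ))))) (cong just (σ⁻¹-of eʳ))

  edgeAt : Fin n → Edge G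
  edgeAt a = proj₁ (cycleEdge a)

  cyclePos-edgeAt : ∀ a → cyclePos (edgeAt a) ≡ just a
  cyclePos-edgeAt a = proj₂ (cycleEdge a)

  cyclePos-injective : ∀ k l a → cyclePos k ≡ just a → cyclePos l ≡ just a → k ≡ l
  cyclePos-injective k l a ek el = edge-unordered-injective k l (ends (cycleStart-just _ _ a ek) (cycleStart-just _ _ a el))
    where
    via : ∀ {p q x y} → σ p ≡ x → σ q ≡ y → p ≡ q → x ≡ y
    via refl refl refl = refl
    ˡ≡ : ∀ {k l} → posˡ k ≡ posˡ l → endˡ G k ≡ endˡ G l
    ˡ≡ = via (σ-posˡ _) (σ-posˡ _)
    ʳ≡ : ∀ {k l} → posʳ k ≡ posʳ l → endʳ G k ≡ endʳ G l
    ʳ≡ = via (σ-posʳ _) (σ-posʳ _)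
    ˡʳ≡ : ∀ {k l} → posˡ k ≡ posʳ l → endˡ G k ≡ endʳ G l
    ˡʳ≡ = via (σ-posˡ _) (σ-posʳ _)
    ʳˡ≡ : ∀ {k l} → posʳ k ≡ posˡ l → endʳ G k ≡ endˡ G l
    ʳˡ≡ = via (σ-posʳ _) (σ-posˡ _)
    ends : (posˡ k ≡ a × posʳ k ≡ next a) ⊎ (posʳ k ≡ a × posˡ k ≡ next a) →
           (posˡ l ≡ a × posʳ l ≡ next a) ⊎ (posʳ l ≡ a × posˡ l ≡ next a) →
           (endˡ G k ≡ endˡ G l × endʳ G k ≡ endʳ G l) ⊎ (endˡ G k ≡ endʳ G l × endʳ G k ≡ endˡ G l)
    ends (inj₁ (x , y)) (inj₁ (x′ , y′)) = inj₁ (ˡ≡ (trans x (sym x′)) , ʳ≡ (trans y (sym y′)))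
    ends (inj₂ (x , y)) (inj₂ (x′ , y′)) = inj₁ (ˡ≡ (trans y (sym y′)) , ʳ≡ (trans x (sym x′)))
    ends (inj₁ (x , y)) (inj₂ (x′ , y′)) = inj₂ (ˡʳ≡ (trans x (sym x′)) , ʳˡ≡ (trans y (sym y′)))
    ends (inj₂ (x , y)) (inj₁ (x′ , y′)) = inj₂ (ˡʳ≡ (trans y (sym y′)) , ʳˡ≡ (trans x (sym x′)))

  cyclePos⇒edgeAt : ∀ {k a} → cyclePos k ≡ just a → k ≡ edgeAt a
  cyclePos⇒edgeAt {k} {a} e = cyclePos-injective k (edgeAt a) a e (cyclePos-edgeAt a)

  edgeAt-injective : ∀ {a b} → edgeAt a ≡ edgeAt b → a ≡ b
  edgeAt-injective {a} {b} e = just-injective (trans (sym (cyclePos-edgeAt a)) (trans (cong cyclePos e) (cyclePos-edgeAt b)))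
    where open import Data.Maybe.Properties using (just-injective)

module ChordWeights {m : ℕ} (G : Graph (suc m)) (simple : IsSimple G)
  (σ : Fin (suc m) → Fin (suc m)) (σ-injective : Injective _≡_ _≡_ σ)
  (cycle : ∀ p → G (σ p) (σ (CyclicDistance.next m p)) ≡ true) (2≤m : 2 ℕ.≤ m)
  (m-even : Parity.odd? m ≡ false) where

  open Parity
  open IntegerSums
  open BaseExpansion
  open EdgeEnumeration
  open LineGraphComplement G simple using (edge-between)
  open CyclePositions G simple σ σ-injective cycle 2≤m
  open CyclicDistance m using (module TwoCycleEdges; next; next-injective; toℕ-next; dist-refl; dist-nx-self; dist-suc; nx<n)
  open CyclicDistance.Order≥3 m 2≤m using (next≢)
  open import Data.Nat.Base as ℕ using (s≤s; z≤n; _^_)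
  import Data.Nat.Properties as ℕ
  open import Data.Integer.Base hiding (suc; pred; _≤_; _^_)
  open import Data.Integer.Properties hiding (≤-refl; ≤-trans)
  open import Data.Fin.Base using (toℕ)
  open import Data.Fin.Properties using (toℕ-injective; toℕ<n) renaming (_≟_ to _≟ᶠ_)
  open import Data.Bool.Base using (Bool; if_then_else_; _∧_; _∨_; not; _xor_)
  open import Data.Maybe.Base using (Maybe; just; nothing)
  open import Data.Product.Base using (Σ; _×_; _,_; proj₁; proj₂)
  open import Data.Sum.Base using (_⊎_; inj₁; inj₂)
  open import Data.Empty using (⊥-elim)
  open import Data.List.Base using (length)
  open import Relation.Nullary using (yes; no)
  open import Relation.Nullary.Decidable using (⌊_⌋)
  open import Relation.Binary.PropositionalEquality
  open import Data.Integer.Tactic.RingSolver using (solve-∀)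
  import Data.Bool.Properties as Bool
  open import Function.Base using (_∘_; case_of_)

  oddAfter : Fin n → Fin n → Bool
  oddAfter a u = odd? (dist {m} (nx {m} (toℕ a)) (toℕ u))

  chordSign : Bool → Bool → ℤ
  chordSign false false = + 1
  chordSign true  true  = - + 1
  chordSign true  false = + 0
  chordSign false true  = + 0

  ∣chordSign∣≤1 : ∀ a b → ∣ chordSign a b ∣ ℕ.≤ 1
  ∣chordSign∣≤1 true  true  = s≤s z≤n
  ∣chordSign∣≤1 true  false = z≤n
  ∣chordSign∣≤1 false true  = z≤n
  ∣chordSign∣≤1 false false = s≤s z≤n

  onChords : Maybe (Fin n) → ℤ → ℤ
  onChords nothing  z = z
  onChords (just _) z = + 0

  χ : Fin n → Edge G → ℤ
  χ a l = onChords (cyclePos l) (chordSign (oddAfter a (posˡ l)) (oddAfter a (posʳ l)))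

  ∣χ∣≤1 : ∀ a l → ∣ χ a l ∣ ℕ.≤ 1
  ∣χ∣≤1 a l with cyclePos l
  ... | nothing = ∣chordSign∣≤1 (oddAfter a (posˡ l)) (oddAfter a (posʳ l))
  ... | just _  = z≤n

  E : ℕ
  E = length (edges G)

  M : ℕ
  M = suc (suc E)

  D : ℕ
  D = M ^ E

  E<M : E ℕ.< M
  E<M = ℕ.≤-trans (ℕ.n<1+n E) (ℕ.n≤1+n (suc E))

  chordPart : Fin n → ℤ
  chordPart a = ∑[ l < E ] (+ (M ^ toℕ l) * χ a l)

  cycleWeight : Fin n → ℤ
  cycleWeight a = + D - chordPart a

  edgeWeightAt : Maybe (Fin n) → Edge G → ℤ
  edgeWeightAt (just a) k = cycleWeight a
  edgeWeightAt nothing  k = + (M ^ toℕ k)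

  edgeWeight : Edge G → ℤ
  edgeWeight k = edgeWeightAt (cyclePos k) k

  δ : Edge G → Edge G → ℤ
  δ k l = if ⌊ k ≟ᶠ l ⌋ then + 1 else + 0

  digitAt : Maybe (Fin n) → Edge G → Edge G → ℤ
  digitAt (just a) k l = - χ a l
  digitAt nothing  k l = δ k l

  -- the base-M digits of edgeWeight k, apart from the leading D of cycle edges
  digit : Edge G → Edge G → ℤ
  digit k = digitAt (cyclePos k) k

  ∣digit∣≤1 : ∀ k l → ∣ digit k l ∣ ℕ.≤ 1
  ∣digit∣≤1 k l with cyclePos k
  ... | just a = subst (ℕ._≤ 1) (sym (∣-i∣≡∣i∣ (χ a l))) (∣χ∣≤1 a l)
  ... | nothing with k ≟ᶠ l
  ...   | yes _ = s≤s z≤n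
  ...   | no _  = z≤n

  δ-≢ : ∀ {k l} → k ≢ l → δ k l ≡ + 0
  δ-≢ {k} {l} k≢l with k ≟ᶠ l
  ... | yes k≡l = ⊥-elim (k≢l k≡l)
  ... | no _    = refl

  δ-refl : ∀ k → δ k k ≡ + 1
  δ-refl k with k ≟ᶠ k
  ... | yes _   = refl
  ... | no k≢k  = ⊥-elim (k≢k refl)

  edgeWeight-positive : ∀ k → Σ ℕ λ j → edgeWeight k ≡ + suc j
  edgeWeight-positive k with cyclePos k
  ... | just a  = D-minus-small (chordPart a) (∣∑pow∣< M (s≤s (s≤s z≤n)) (χ a) (∣χ∣≤1 a))
    where
    D-minus-small : ∀ R → ∣ R ∣ ℕ.< D → Σ ℕ λ j → + D - R ≡ + suc j
    D-minus-small (+ r)      lt = D ℕ.∸ suc r , trans (m-n≡m⊖n D r) (trans (⊖-≥ (ℕ.<⇒≤ lt)) (cong +_ (ℕ.+-∸-assoc 1 lt)))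
    D-minus-small -[1+ r ]   lt with D
    ... | suc D′ = D′ ℕ.+ suc r , refl
  ... | nothing = ℕ.pred (M ^ toℕ k) , cong +_ (sym (ℕ.suc-pred (M ^ toℕ k) {{ℕ.>-nonZero (ℕ.m^n>0 M (toℕ k))}}))

  edgeWeight-expansion : ∀ k → edgeWeight k ≡ when (isCycleEdge k) (+ D) + ∑[ l < E ] (+ (M ^ toℕ l) * digit k l)
  edgeWeight-expansion k with cyclePos k
  ... | just a = cong (_+_ (+ D)) (sym (trans (sum-cong-≗ (λ l → sym (neg-distribʳ-* (+ (M ^ toℕ l)) (χ a l)))) (sum-neg (λ l → + (M ^ toℕ l) * χ a l))))
  ... | nothing = sym (trans (+-identityˡ _) (trans (sum-single _ k others) (trans (cong (+ (M ^ toℕ k) *_) (δ-refl k)) (*-identityʳ _))))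
    where
    others : ∀ l → l ≢ k → + (M ^ toℕ l) * δ k l ≡ + 0
    others l l≢k = trans (cong (+ (M ^ toℕ l) *_) (δ-≢ (λ k≡l → l≢k (sym k≡l)))) (*-zeroʳ (+ (M ^ toℕ l)))

  total : Subset E → ℤ
  total S = ∑[ k < E ] when (S k) (edgeWeight k)

  digitSum : Subset E → Edge G → ℤ
  digitSum S l = ∑[ k < E ] when (S k) (digit k l)

  cycleEdgesIn : Subset E → Subset E
  cycleEdgesIn S k = S k ∧ isCycleEdge k

  total-expansion : ∀ S → total S ≡ + count (cycleEdgesIn S) * + D + ∑[ l < E ] (+ (M ^ toℕ l) * digitSum S l)
  total-expansion S = begin
    total S                                  ≡⟨ sum-cong-≗ split ⟩
    ∑[ k < E ] (leading k + digits k)        ≡⟨ ∑-distrib-+ leading digits ⟩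
    sum leading + sum digits                 ≡⟨ cong₂ _+_ leading-sum digits-sum ⟩
    + count (cycleEdgesIn S) * + D + ∑[ l < E ] (+ (M ^ toℕ l) * digitSum S l) ∎
    where
    open ≡-Reasoning
    leading digits : Edge G → ℤ
    leading k = + D * when (cycleEdgesIn S k) (+ 1)
    digits k = ∑[ l < E ] (+ (M ^ toℕ l) * when (S k) (digit k l))
    split : ∀ k → when (S k) (edgeWeight k) ≡ leading k + digits k
    split k = begin
      when (S k) (edgeWeight k)
        ≡⟨ cong (when (S k)) (edgeWeight-expansion k) ⟩
      when (S k) (when (isCycleEdge k) (+ D) + ∑[ l < E ] (+ (M ^ toℕ l) * digit k l))
        ≡⟨ when-+ (S k) (when (isCycleEdge k) (+ D)) (∑[ l < E ] (+ (M ^ toℕ l) * digit k l)) ⟩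
      when (S k) (when (isCycleEdge k) (+ D)) + when (S k) (∑[ l < E ] (+ (M ^ toℕ l) * digit k l))
        ≡⟨ cong₂ _+_ (when-∧ (S k) (isCycleEdge k) (+ D)) (when-sum (S k) (λ l → + (M ^ toℕ l) * digit k l)) ⟩
      when (cycleEdgesIn S k) (+ D) + ∑[ l < E ] when (S k) (+ (M ^ toℕ l) * digit k l)
        ≡⟨ cong₂ _+_ (trans (when≡when1* (cycleEdgesIn S k) (+ D)) (*-comm _ (+ D))) (sum-cong-≗ (λ l → when-*ˡ (S k) (+ (M ^ toℕ l)) (digit k l))) ⟩
      leading k + digits k ∎
    leading-sum : sum leading ≡ + count (cycleEdgesIn S) * + D
    leading-sum = trans (sum-*ˡ (+ D) (λ k → when (cycleEdgesIn S k) (+ 1))) (trans (cong (+ D *_) (sum-when1≡count (cycleEdgesIn S))) (*-comm (+ D) _))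
    digits-sum : sum digits ≡ ∑[ l < E ] (+ (M ^ toℕ l) * digitSum S l)
    digits-sum = trans (∑-comm (λ k l → + (M ^ toℕ l) * when (S k) (digit k l)))
      (sum-cong-≗ (λ l → sum-*ˡ (+ (M ^ toℕ l)) (λ k → when (S k) (digit k l))))

  private
    ∣digitSum∣≤E : ∀ S l → ∣ digitSum S l ∣ ℕ.≤ E
    ∣digitSum∣≤E S l = subst (∣ digitSum S l ∣ ℕ.≤_) (ℕ.*-identityʳ E)
      (∣sum∣≤ (λ k → when (S k) (digit k l)) 1 (λ k → ∣when∣≤ (S k) (∣digit∣≤1 k l)))

  total≡2D⇒ : ∀ S → total S ≡ + 2 * + D → count (cycleEdgesIn S) ≡ 2 × (∀ l → digitSum S l ≡ + 0)
  total≡2D⇒ S e with N*P+R≡2*P⇒ (count (cycleEdgesIn S)) D _ (∣∑pow∣< M E<M (digitSum S) (∣digitSum∣≤E S)) (trans (sym (total-expansion S)) e)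
  ... | two , no-digits = two , ∑pow≡0⇒≡0 M E<M (digitSum S) (∣digitSum∣≤E S) no-digits

  total≡2D⇐ : ∀ S → count (cycleEdgesIn S) ≡ 2 → (∀ l → digitSum S l ≡ + 0) → total S ≡ + 2 * + D
  total≡2D⇐ S two no-digits = begin
    total S                                                                   ≡⟨ total-expansion S ⟩
    + count (cycleEdgesIn S) * + D + ∑[ l < E ] (+ (M ^ toℕ l) * digitSum S l) ≡⟨ cong₂ (λ c d → + c * + D + d) two (sum-zero _ (λ l → trans (cong (+ (M ^ toℕ l) *_) (no-digits l)) (*-zeroʳ (+ (M ^ toℕ l))))) ⟩
    + 2 * + D + + 0                                                           ≡⟨ +-identityʳ _ ⟩
    + 2 * + D                                                                 ∎
    where open ≡-Reasoning

  digit-chord : ∀ {k} l → cyclePos k ≡ nothing → digit k l ≡ δ k l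
  digit-chord l e rewrite e = refl

  χ-cycle : ∀ a {l b} → cyclePos l ≡ just b → χ a l ≡ + 0
  χ-cycle a e rewrite e = refl

  χ-chord : ∀ a {l} → cyclePos l ≡ nothing → χ a l ≡ chordSign (oddAfter a (posˡ l)) (oddAfter a (posʳ l))
  χ-chord a e rewrite e = refl

  CycleEdgesOf : Subset E → Fin n → Fin n → Set
  CycleEdgesOf S a b = a ≢ b × S (edgeAt a) ≡ true × S (edgeAt b) ≡ true ×
    (∀ k → cycleEdgesIn S k ≡ true → k ≡ edgeAt a ⊎ k ≡ edgeAt b)

  ChordsMatch : Subset E → Fin n → Fin n → Set
  ChordsMatch S a b = ∀ l → cyclePos l ≡ nothing → when (S l) (+ 1) ≡ χ a l + χ b l

  private
    ∧-true : ∀ {b c} → (b ∧ c) ≡ true → b ≡ true × c ≡ true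
    ∧-true {true} {true} _ = refl , refl

    isCycleEdge-cyclePos : ∀ k → isCycleEdge k ≡ true → Σ (Fin n) λ a → cyclePos k ≡ just a
    isCycleEdge-cyclePos k e with cyclePos k
    ... | just a = a , refl

    isCycleEdge-false : ∀ k → isCycleEdge k ≡ false → cyclePos k ≡ nothing
    isCycleEdge-false k e with cyclePos k
    ... | nothing = refl

    cycleEdgesIn-edgeAt : ∀ S a → S (edgeAt a) ≡ true → cycleEdgesIn S (edgeAt a) ≡ true
    cycleEdgesIn-edgeAt S a s rewrite s | cyclePos-edgeAt a = refl

  CycleEdgesOf⇒count≡2 : ∀ {S a b} → CycleEdgesOf S a b → count (cycleEdgesIn S) ≡ 2
  CycleEdgesOf⇒count≡2 {S} {a} {b} (a≢b , sa , sb , only) = +-injective (begin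
    + count (cycleEdgesIn S)                                   ≡⟨ sum-when1≡count (cycleEdgesIn S) ⟨
    ∑[ k < E ] when (cycleEdgesIn S k) (+ 1)                   ≡⟨ sum-pair _ (edgeAt a) (edgeAt b) (a≢b ∘ edgeAt-injective) others ⟩
    when (cycleEdgesIn S (edgeAt a)) (+ 1) + when (cycleEdgesIn S (edgeAt b)) (+ 1)
                                                               ≡⟨ cong₂ (λ u v → when u (+ 1) + when v (+ 1)) (cycleEdgesIn-edgeAt S a sa) (cycleEdgesIn-edgeAt S b sb) ⟩
    + 2                                                        ∎)
    where
    open ≡-Reasoning
    others : ∀ k → k ≢ edgeAt a → k ≢ edgeAt b → when (cycleEdgesIn S k) (+ 1) ≡ + 0
    others k k≢a k≢b with cycleEdgesIn S k in e
    ... | false = refl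
    ... | true with only k e
    ...   | inj₁ k≡a = ⊥-elim (k≢a k≡a)
    ...   | inj₂ k≡b = ⊥-elim (k≢b k≡b)

  digitSum-two : ∀ {S a b} → CycleEdgesOf S a b → ∀ l → digitSum S l ≡ when (S l ∧ not (isCycleEdge l)) (+ 1) - (χ a l + χ b l)
  digitSum-two {S} {a} {b} (a≢b , sa , sb , only) l = begin
    digitSum S l                                    ≡⟨ sum-cong-≗ split ⟩
    ∑[ k < E ] (onCycle k + offCycle k)             ≡⟨ ∑-distrib-+ onCycle offCycle ⟩
    sum onCycle + sum offCycle                      ≡⟨ cong₂ _+_ (sum-pair onCycle (edgeAt a) (edgeAt b) (a≢b ∘ edgeAt-injective) onCycle-others) (sum-single offCycle l offCycle-others) ⟩
    (onCycle (edgeAt a) + onCycle (edgeAt b)) + offCycle l ≡⟨ cong₂ _+_ (cong₂ _+_ (onCycle-at a sa) (onCycle-at b sb)) offCycle-l ⟩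
    (- χ a l + - χ b l) + when (S l ∧ not (isCycleEdge l)) (+ 1) ≡⟨ rearrange (χ a l) (χ b l) (when (S l ∧ not (isCycleEdge l)) (+ 1)) ⟩
    when (S l ∧ not (isCycleEdge l)) (+ 1) - (χ a l + χ b l) ∎
    where
    open ≡-Reasoning
    rearrange : ∀ x y z → (- x + - y) + z ≡ z - (x + y)
    rearrange = solve-∀
    onCycle offCycle : Edge G → ℤ
    onCycle  k = when (cycleEdgesIn S k) (digit k l)
    offCycle k = when (S k ∧ not (isCycleEdge k)) (digit k l)
    split : ∀ k → when (S k) (digit k l) ≡ onCycle k + offCycle k
    split k with S k | isCycleEdge k
    ... | true  | true  = sym (+-identityʳ _)
    ... | true  | false = sym (+-identityˡ _)
    ... | false | _     = refl
    onCycle-others : ∀ k → k ≢ edgeAt a → k ≢ edgeAt b → onCycle k ≡ + 0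
    onCycle-others k k≢a k≢b with cycleEdgesIn S k in e
    ... | false = refl
    ... | true with only k e
    ...   | inj₁ k≡a = ⊥-elim (k≢a k≡a)
    ...   | inj₂ k≡b = ⊥-elim (k≢b k≡b)
    offCycle-others : ∀ k → k ≢ l → offCycle k ≡ + 0
    offCycle-others k k≢l with S k | isCycleEdge k in c
    ... | false | _     = refl
    ... | true  | true  = refl
    ... | true  | false = trans (digit-chord l (isCycleEdge-false k c)) (δ-≢ k≢l)
    onCycle-at : ∀ c → S (edgeAt c) ≡ true → onCycle (edgeAt c) ≡ - χ c l
    onCycle-at c s rewrite s | cyclePos-edgeAt c = refl
    offCycle-l : offCycle l ≡ when (S l ∧ not (isCycleEdge l)) (+ 1)
    offCycle-l with S l | isCycleEdge l in c
    ... | false | _     = refl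
    ... | true  | true  = refl
    ... | true  | false = trans (digit-chord l (isCycleEdge-false l c)) (δ-refl l)

  module _ {S a b} (edges-ab : CycleEdgesOf S a b) where

    digitSum≡0⇒ChordsMatch : (∀ l → digitSum S l ≡ + 0) → ChordsMatch S a b
    digitSum≡0⇒ChordsMatch no-digits l c = i-j≡0⇒i≡j _ _ (begin
      when (S l) (+ 1) - (χ a l + χ b l)                          ≡⟨ cong (λ s → when s (+ 1) - (χ a l + χ b l)) (chord-part c) ⟨
      when (S l ∧ not (isCycleEdge l)) (+ 1) - (χ a l + χ b l)    ≡⟨ digitSum-two edges-ab l ⟨
      digitSum S l                                                ≡⟨ no-digits l ⟩
      + 0                                                         ∎)
      where
      open ≡-Reasoning
      chord-part : cyclePos l ≡ nothing → (S l ∧ not (isCycleEdge l)) ≡ S l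
      chord-part c rewrite c = Bool.∧-identityʳ (S l)

    ChordsMatch⇒digitSum≡0 : ChordsMatch S a b → ∀ l → digitSum S l ≡ + 0
    ChordsMatch⇒digitSum≡0 match l with cyclePos l in c
    ... | nothing = trans (digitSum-two edges-ab l) (i≡j⇒i-j≡0 (trans (cong (λ s → when s (+ 1)) chord-part) (match l c)))
      where
      chord-part : (S l ∧ not (isCycleEdge l)) ≡ S l
      chord-part rewrite c = Bool.∧-identityʳ (S l)
    ... | just _ = trans (digitSum-two edges-ab l) (begin
      when (S l ∧ not (isCycleEdge l)) (+ 1) - (χ a l + χ b l) ≡⟨ cong₂ (λ s x → when s (+ 1) - x) cycle-part (cong₂ _+_ (χ-cycle a c) (χ-cycle b c)) ⟩
      + 0 - (+ 0 + + 0)                                         ≡⟨⟩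
      + 0                                                       ∎)
      where
      open ≡-Reasoning
      cycle-part : (S l ∧ not (isCycleEdge l)) ≡ false
      cycle-part rewrite c = Bool.∧-zeroʳ (S l)

  cycleStar : Fin n → Subset E
  cycleStar v k = (posˡ k ==ᶠ v) ∨ (posʳ k ==ᶠ v)

  cycleStar⇒ : ∀ {v k} → cycleStar v k ≡ true → posˡ k ≡ v ⊎ posʳ k ≡ v
  cycleStar⇒ {v} {k} e with posˡ k ≟ᶠ v | posʳ k ≟ᶠ v
  ... | yes p | _     = inj₁ p
  ... | no _  | yes q = inj₂ q

  cycleStar⇐ : ∀ {v k} → posˡ k ≡ v ⊎ posʳ k ≡ v → cycleStar v k ≡ true
  cycleStar⇐ {v} {k} h with posˡ k ≟ᶠ v | posʳ k ≟ᶠ v | h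
  ... | yes _ | _     | _       = refl
  ... | no _  | yes _ | _       = refl
  ... | no ¬p | no _  | inj₁ p  = ⊥-elim (¬p p)
  ... | no _  | no ¬q | inj₂ q  = ⊥-elim (¬q q)

  private
    ends-edgeAt : ∀ b → (posˡ (edgeAt b) ≡ b × posʳ (edgeAt b) ≡ next b) ⊎ (posʳ (edgeAt b) ≡ b × posˡ (edgeAt b) ≡ next b)
    ends-edgeAt b = cycleStart-just _ _ b (cyclePos-edgeAt b)

  cycleStar-edgeAt⁻ : ∀ a b → cycleStar (next a) (edgeAt b) ≡ true → b ≡ a ⊎ b ≡ next a
  cycleStar-edgeAt⁻ a b s with ends-edgeAt b | cycleStar⇒ s
  ... | inj₁ (x , _) | inj₁ u = inj₂ (trans (sym x) u)
  ... | inj₁ (_ , y) | inj₂ u = inj₁ (next-injective b a (trans (sym y) u))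
  ... | inj₂ (_ , y) | inj₁ u = inj₁ (next-injective b a (trans (sym y) u))
  ... | inj₂ (x , _) | inj₂ u = inj₂ (trans (sym x) u)

  cycleStar-edgeAt⁺ : ∀ a b → b ≡ a ⊎ b ≡ next a → cycleStar (next a) (edgeAt b) ≡ true
  cycleStar-edgeAt⁺ a b h with ends-edgeAt b | h
  ... | inj₁ (_ , y) | inj₁ refl = cycleStar⇐ (inj₂ y)
  ... | inj₁ (x , _) | inj₂ refl = cycleStar⇐ (inj₁ x)
  ... | inj₂ (_ , y) | inj₁ refl = cycleStar⇐ (inj₁ y)
  ... | inj₂ (x , _) | inj₂ refl = cycleStar⇐ (inj₂ x)

  star-CycleEdgesOf : ∀ a → CycleEdgesOf (cycleStar (next a)) a (next a)
  star-CycleEdgesOf a = (λ e → next≢ a (sym e)) , cycleStar-edgeAt⁺ a a (inj₁ refl) , cycleStar-edgeAt⁺ a (next a) (inj₂ refl) , only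
    where
    only : ∀ k → cycleEdgesIn (cycleStar (next a)) k ≡ true → k ≡ edgeAt a ⊎ k ≡ edgeAt (next a)
    only k e with sk , ck ← ∧-true e with b , cb ← isCycleEdge-cyclePos k ck
      with cycleStar-edgeAt⁻ a b (subst (λ k → cycleStar (next a) k ≡ true) (cyclePos⇒edgeAt cb) sk)
    ... | inj₁ refl = inj₁ (cyclePos⇒edgeAt cb)
    ... | inj₂ refl = inj₂ (cyclePos⇒edgeAt cb)

  oddAfter-next : ∀ a → oddAfter a (next a) ≡ false × oddAfter (next a) (next a) ≡ false
  oddAfter-next a =
    cong odd? (trans (cong (dist {m} s) (toℕ-next a)) (dist-refl s (nx<n (toℕ a)))) ,
    trans (cong odd? (trans (cong (λ z → dist {m} (nx {m} z) z) (toℕ-next a)) (dist-nx-self s (nx<n (toℕ a))))) m-even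
    where s = nx {m} (toℕ a)

  oddAfter-step : ∀ a u → u ≢ next a → oddAfter a u ≡ not (oddAfter (next a) u)
  oddAfter-step a u u≢ = trans (cong odd? (dist-suc (nx {m} (toℕ a)) (toℕ u) (nx<n (toℕ a)) (toℕ<n u) s≢u))
    (cong (λ z → not (odd? (dist {m} (nx {m} z) (toℕ u)))) (sym (toℕ-next a)))
    where
    s≢u : nx {m} (toℕ a) ≢ toℕ u
    s≢u e = u≢ (toℕ-injective (trans (sym e) (sym (toℕ-next a))))

  -- Moving the reference point from a + 1 to a + 2 flips the parity of every position except a + 1.
  χ-consecutive : ∀ a l → cyclePos l ≡ nothing → χ a l + χ (next a) l ≡ when (cycleStar (next a) l) (+ 1)
  χ-consecutive a l c rewrite χ-chord a c | χ-chord (next a) c = consecutive (posˡ l) (posʳ l) (posˡ≢posʳ l)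
    where
    flip-first : ∀ y → chordSign false (not y) + chordSign false y ≡ + 1
    flip-first true  = refl
    flip-first false = refl
    flip-second : ∀ x → chordSign (not x) false + chordSign x false ≡ + 1
    flip-second true  = refl
    flip-second false = refl
    flip-both : ∀ x y → chordSign (not x) (not y) + chordSign x y ≡ + 0
    flip-both true  true  = refl
    flip-both true  false = refl
    flip-both false true  = refl
    flip-both false false = refl
    consecutive : ∀ p q → p ≢ q → chordSign (oddAfter a p) (oddAfter a q) + chordSign (oddAfter (next a) p) (oddAfter (next a) q)
                                  ≡ when ((p ==ᶠ next a) ∨ (q ==ᶠ next a)) (+ 1)
    consecutive p q p≢q with p ≟ᶠ next a | q ≟ᶠ next a
    ... | yes p≡ | yes q≡ = ⊥-elim (p≢q (trans p≡ (sym q≡)))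
    ... | yes refl | no q≢ rewrite proj₁ (oddAfter-next a) | proj₂ (oddAfter-next a) | oddAfter-step a q q≢ = flip-first (oddAfter (next a) q)
    ... | no p≢ | yes refl rewrite proj₁ (oddAfter-next a) | proj₂ (oddAfter-next a) | oddAfter-step a p p≢ = flip-second (oddAfter (next a) p)
    ... | no p≢ | no q≢ rewrite oddAfter-step a p p≢ | oddAfter-step a q q≢ = flip-both (oddAfter (next a) p) (oddAfter (next a) q)

  total-star : ∀ a → total (cycleStar (next a)) ≡ + 2 * + D
  total-star a = total≡2D⇐ _ (CycleEdgesOf⇒count≡2 (star-CycleEdgesOf a))
    (ChordsMatch⇒digitSum≡0 (star-CycleEdgesOf a) (λ l c → sym (χ-consecutive a l c)))

  IsBit : ℤ → Set
  IsBit z = z ≡ + 0 ⊎ z ≡ + 1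

  when-isBit : ∀ b → IsBit (when b (+ 1))
  when-isBit true  = inj₂ refl
  when-isBit false = inj₁ refl

  chordIndex : ∀ p q → IsChord G σ p q →
    Σ (Edge G) λ l → cyclePos l ≡ nothing × (∀ x → χ x l ≡ chordSign (oddAfter x p) (oddAfter x q))
  chordIndex p q (pq , _ , ¬pq , ¬qp) with edge-between (σ p) (σ q) pq
  ... | l , inj₁ (eˡ , eʳ) = l , c , λ x → trans (χ-chord x c) (cong₂ (λ u v → chordSign (oddAfter x u) (oddAfter x v)) l≡p r≡q)
    where
    l≡p = trans (cong σ⁻¹ eˡ) (σ⁻¹-σ p)
    r≡q = trans (cong σ⁻¹ eʳ) (σ⁻¹-σ q)
    c : cyclePos l ≡ nothing
    c = cycleStart-chord (posˡ l) (posʳ l) (λ e → ¬pq (trans (sym (toℕ-next p)) (cong toℕ (trans (cong next (sym l≡p)) (trans e r≡q)))))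
                                           (λ e → ¬qp (trans (sym (toℕ-next q)) (cong toℕ (trans (cong next (sym r≡q)) (trans e l≡p)))))
  ... | l , inj₂ (eˡ , eʳ) = l , c , λ x → trans (χ-chord x c) (trans (cong₂ (λ u v → chordSign (oddAfter x u) (oddAfter x v)) l≡q r≡p) (chordSign-comm (oddAfter x q) (oddAfter x p)))
    where
    l≡q = trans (cong σ⁻¹ eˡ) (σ⁻¹-σ q)
    r≡p = trans (cong σ⁻¹ eʳ) (σ⁻¹-σ p)
    chordSign-comm : ∀ a b → chordSign a b ≡ chordSign b a
    chordSign-comm true  true  = refl
    chordSign-comm true  false = refl
    chordSign-comm false true  = refl
    chordSign-comm false false = refl
    c : cyclePos l ≡ nothing
    c = cycleStart-chord (posˡ l) (posʳ l) (λ e → ¬qp (trans (sym (toℕ-next q)) (cong toℕ (trans (cong next (sym l≡q)) (trans e r≡p)))))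
                                           (λ e → ¬pq (trans (sym (toℕ-next p)) (cong toℕ (trans (cong next (sym r≡p)) (trans e l≡q)))))

  private
    equal-parities⇒¬bit : ∀ b → ¬ IsBit (chordSign b b + chordSign b b)
    equal-parities⇒¬bit true  (inj₁ ())
    equal-parities⇒¬bit true  (inj₂ ())
    equal-parities⇒¬bit false (inj₁ ())
    equal-parities⇒¬bit false (inj₂ ())

    odd-crossing⇒¬bit : ∀ b → ¬ IsBit (chordSign true b + chordSign true (not b))
    odd-crossing⇒¬bit true  (inj₁ ())
    odd-crossing⇒¬bit true  (inj₂ ())
    odd-crossing⇒¬bit false (inj₁ ())
    odd-crossing⇒¬bit false (inj₂ ())

    xor≡false⇒≡ : ∀ a b → a xor b ≡ false → a ≡ b
    xor≡false⇒≡ true  true  _ = refl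
    xor≡false⇒≡ false false _ = refl

  BadChord : Fin n → Fin n → Set
  BadChord a b = Σ (Edge G) λ l → cyclePos l ≡ nothing × ¬ IsBit (χ a l + χ b l)

  module _ (a b : Fin n) (a≢b : toℕ a ≢ toℕ b) where
    open TwoCycleEdges m-even (toℕ a) (toℕ b) (toℕ<n a) (toℕ<n b) a≢b

    module _ (L-even : odd? L ≡ false) where

      noncrossingEven⇒BadChord : ∀ p q → IsChord G σ p q → dist {m} s (toℕ p) ℕ.≤ L → dist {m} s (toℕ q) ℕ.≤ L →
        ℕ.∣ dist {m} s (toℕ p) - dist {m} s (toℕ q) ∣ ℕ.% 2 ≡ 0 → BadChord a b
      noncrossingEven⇒BadChord p q chord p-on q-on even-gap with l , c , χ≡ ← chordIndex p q chord =
        l , c , subst (λ z → ¬ IsBit z) (sym (cong₂ _+_ (χ≡ a) (χ≡ b)))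
          (subst₂ (λ u v → ¬ IsBit (chordSign (oddAfter a p) (oddAfter a q) + chordSign u v)) (sym b≡a-p) (sym b≡a-q)
            (subst (λ u → ¬ IsBit (chordSign (oddAfter a p) u + chordSign (oddAfter a p) u)) p≡q (equal-parities⇒¬bit (oddAfter a p))))
        where
        b≡a-p : oddAfter b p ≡ oddAfter a p
        b≡a-p = parity-onPath L-even (toℕ p) (toℕ<n p) p-on
        b≡a-q : oddAfter b q ≡ oddAfter a q
        b≡a-q = parity-onPath L-even (toℕ q) (toℕ<n q) q-on
        p≡q : oddAfter a p ≡ oddAfter a q
        p≡q = xor≡false⇒≡ _ _ (trans (sym (odd?-∣-∣ (dist {m} s (toℕ p)) (dist {m} s (toℕ q)))) (%2≡0⇒¬odd? ℕ.∣ dist {m} s (toℕ p) - dist {m} s (toℕ q) ∣ even-gap))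

      crossingOdd⇒BadChord : ∀ p q → IsChord G σ p q → dist {m} s (toℕ p) ℕ.≤ L → ¬ dist {m} s (toℕ q) ℕ.≤ L →
        dist {m} s (toℕ p) ℕ.% 2 ≡ 1 → BadChord a b
      crossingOdd⇒BadChord p q chord p-on q-off p-odd with l , c , χ≡ ← chordIndex p q chord =
        l , c , subst (λ z → ¬ IsBit z) (sym (cong₂ _+_ (χ≡ a) (χ≡ b)))
          (subst₂ (λ u v → ¬ IsBit (chordSign u (oddAfter a q) + chordSign v (oddAfter b q))) (sym a-p) (sym b-p)
            (subst (λ v → ¬ IsBit (chordSign true (oddAfter a q) + chordSign true v)) (sym b-q) (odd-crossing⇒¬bit (oddAfter a q))))
        where
        a-p : oddAfter a p ≡ true
        a-p = %2≡1⇒odd? (dist {m} s (toℕ p)) p-odd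
        b-p : oddAfter b p ≡ true
        b-p = trans (parity-onPath L-even (toℕ p) (toℕ<n p) p-on) a-p
        b-q : oddAfter b q ≡ not (oddAfter a q)
        b-q = parity-offPath L-even (toℕ q) (toℕ<n q) (ℕ.≰⇒> q-off)

  private
    NonCrossingEvenAlong CrossingOddAlong : ℕ × ℕ → Set
    NonCrossingEvenAlong (s , L) = Σ (Fin n) λ p → Σ (Fin n) λ q → IsChord G σ p q ×
      OnP {m} (s , L) p × OnP {m} (s , L) q × ℕ.∣ dist {m} s (toℕ p) - dist {m} s (toℕ q) ∣ ℕ.% 2 ≡ 0
    CrossingOddAlong (s , L) = Σ (Fin n) λ p → Σ (Fin n) λ q → IsChord G σ p q ×
      OnP {m} (s , L) p × ¬ OnP {m} (s , L) q × dist {m} s (toℕ p) ℕ.% 2 ≡ 1 × (L ℕ.∸ dist {m} s (toℕ p)) ℕ.% 2 ≡ 1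

    BadChord-comm : ∀ {a b} → BadChord b a → BadChord a b
    BadChord-comm {a} {b} (l , c , ¬bit) = l , c , ¬bit ∘ subst IsBit (+-comm (χ a l) (χ b l))

    P₀-by-parity : ∀ a b → P₀ {m} a b ≡ (if odd? (dist {m} (nx {m} (toℕ a)) (toℕ b))
                                           then (nx {m} (toℕ b) , dist {m} (nx {m} (toℕ b)) (toℕ a))
                                           else (nx {m} (toℕ a) , dist {m} (nx {m} (toℕ a)) (toℕ b)))
    P₀-by-parity a b rewrite %2≡if-odd? (dist {m} (nx {m} (toℕ a)) (toℕ b)) with odd? (dist {m} (nx {m} (toℕ a)) (toℕ b))
    ... | true  = refl
    ... | false = refl

    along-even-path : ∀ a b (a≢b : toℕ a ≢ toℕ b) → odd? (dist {m} (nx {m} (toℕ a)) (toℕ b)) ≡ false →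
      NonCrossingEvenAlong (nx {m} (toℕ a) , dist {m} (nx {m} (toℕ a)) (toℕ b)) ⊎ CrossingOddAlong (nx {m} (toℕ a) , dist {m} (nx {m} (toℕ a)) (toℕ b)) →
      BadChord a b
    along-even-path a b a≢b L-even (inj₁ (p , q , chord , p-on , q-on , even-gap)) = noncrossingEven⇒BadChord a b a≢b L-even p q chord p-on q-on even-gap
    along-even-path a b a≢b L-even (inj₂ (p , q , chord , p-on , q-off , p-odd , _)) = crossingOdd⇒BadChord a b a≢b L-even p q chord p-on q-off p-odd

  -- The even path P₀ runs from a + 1 to b, or else from b + 1 to a.
  badGraph⇒BadChord : ∀ a b → DisjointCycleEdges {m} a b → NonCrossingEvenChord G σ a b ⊎ CrossingOddChord G σ a b → BadChord a b
  badGraph⇒BadChord a b (a≢b , _) h =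
    go (odd? (dist {m} (nx {m} (toℕ a)) (toℕ b))) refl (subst (λ c → NonCrossingEvenAlong c ⊎ CrossingOddAlong c) (P₀-by-parity a b) h)
    where
    from-a from-b : ℕ × ℕ
    from-a = nx {m} (toℕ a) , dist {m} (nx {m} (toℕ a)) (toℕ b)
    from-b = nx {m} (toℕ b) , dist {m} (nx {m} (toℕ b)) (toℕ a)
    go : ∀ o → odd? (dist {m} (nx {m} (toℕ a)) (toℕ b)) ≡ o →
      NonCrossingEvenAlong (if o then from-b else from-a) ⊎ CrossingOddAlong (if o then from-b else from-a) → BadChord a b
    go false parity = along-even-path a b a≢b parity
    go true  parity h′ = BadChord-comm {a} {b} (along-even-path b a (a≢b ∘ sym) (otherPath-even parity) h′)
      where open TwoCycleEdges m-even (toℕ a) (toℕ b) (toℕ<n a) (toℕ<n b) a≢b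

  count≡2⇒CycleEdgesOf : ∀ S → count (cycleEdgesIn S) ≡ 2 → Σ (Fin n) λ a → Σ (Fin n) λ b → CycleEdgesOf S a b
  count≡2⇒CycleEdgesOf S two with count≡2 (cycleEdgesIn S) two
  ... | k₁ , k₂ , k₁≢k₂ , in₁ , in₂ , only
    with s₁ , c₁ ← ∧-true in₁ | s₂ , c₂ ← ∧-true in₂
    with a , ca ← isCycleEdge-cyclePos k₁ c₁ | b , cb ← isCycleEdge-cyclePos k₂ c₂
    with refl ← cyclePos⇒edgeAt ca | refl ← cyclePos⇒edgeAt cb =
    a , b , (λ { refl → k₁≢k₂ refl }) , s₁ , s₂ , only

  CycleEdgesOf-comm : ∀ {S a b} → CycleEdgesOf S a b → CycleEdgesOf S b a
  CycleEdgesOf-comm (a≢b , sa , sb , only) = a≢b ∘ sym , sb , sa , λ k e → Sum.swap (only k e)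
    where import Data.Sum.Base as Sum

  ChordsMatch-comm : ∀ {S a b} → ChordsMatch S a b → ChordsMatch S b a
  ChordsMatch-comm {a = a} {b} match l c = trans (match l c) (+-comm (χ a l) (χ b l))

  consecutive⇒star : ∀ {S a} → CycleEdgesOf S a (next a) → ChordsMatch S a (next a) → ∀ k → S k ≡ cycleStar (next a) k
  consecutive⇒star {S} {a} (_ , sa , sna , only) match k with cyclePos k in ck
  ... | nothing = when-injective (trans (match k ck) (χ-consecutive a k ck))
    where
    when-injective : ∀ {b c} → when b (+ 1) ≡ when c (+ 1) → b ≡ c
    when-injective {true}  {true}  _ = refl
    when-injective {false} {false} _ = refl
  ... | just b with refl ← cyclePos⇒edgeAt ck with S (edgeAt b) in sk | cycleStar (next a) (edgeAt b) in stk
  ...   | true  | true  = refl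
  ...   | false | false = refl
  ...   | true  | false = case trans (sym (cycleStar-edgeAt⁺ a b b≡)) stk of λ ()
    where
    b≡ : b ≡ a ⊎ b ≡ next a
    b≡ with only (edgeAt b) (cycleEdgesIn-edgeAt S b sk)
    ... | inj₁ e = inj₁ (edgeAt-injective e)
    ... | inj₂ e = inj₂ (edgeAt-injective e)
  ...   | false | true  = case trans (sym (S-edgeAt (cycleStar-edgeAt⁻ a b stk))) sk of λ ()
    where
    S-edgeAt : b ≡ a ⊎ b ≡ next a → S (edgeAt b) ≡ true
    S-edgeAt (inj₁ refl) = sa
    S-edgeAt (inj₂ refl) = sna

  module _ (bad : ∀ a b → DisjointCycleEdges {m} a b → NonCrossingEvenChord G σ a b ⊎ CrossingOddChord G σ a b) where

    matching⇒star : ∀ {S a b} → CycleEdgesOf S a b → ChordsMatch S a b → Σ (Fin n) λ v → ∀ k → S k ≡ cycleStar v k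
    matching⇒star {S} {a} {b} edges-ab match with b ≟ᶠ next a
    ... | yes refl = next a , consecutive⇒star edges-ab match
    ... | no b≢a⁺ with a ≟ᶠ next b
    ...   | yes refl = next b , consecutive⇒star (CycleEdgesOf-comm edges-ab) (ChordsMatch-comm {S} {next b} {b} match)
    ...   | no a≢b⁺ = ⊥-elim (no-BadChord (badGraph⇒BadChord a b disjoint (bad a b disjoint)))
      where
      disjoint : DisjointCycleEdges {m} a b
      disjoint = proj₁ edges-ab ∘ toℕ-injective ,
                 (λ e → b≢a⁺ (sym (toℕ-injective (trans (toℕ-next a) e)))) ,
                 (λ e → a≢b⁺ (sym (toℕ-injective (trans (toℕ-next b) e))))
      no-BadChord : ¬ BadChord a b
      no-BadChord (l , c , ¬bit) = ¬bit (subst IsBit (match l c) (when-isBit (S l)))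

    total≡2D⇒star : ∀ S → total S ≡ + 2 * + D → Σ (Fin n) λ v → ∀ k → S k ≡ cycleStar v k
    total≡2D⇒star S e = from-edges (count≡2⇒CycleEdgesOf S (proj₁ (total≡2D⇒ S e)))
      where
      from-edges : (Σ (Fin n) λ a → Σ (Fin n) λ b → CycleEdgesOf S a b) → Σ (Fin n) λ v → ∀ k → S k ≡ cycleStar v k
      from-edges (a , b , edges-ab) = matching⇒star edges-ab (digitSum≡0⇒ChordsMatch edges-ab (proj₂ (total≡2D⇒ S e)))

module BadGraph {m : ℕ} (G : Graph (suc m)) (simple : IsSimple G) (triangle-free : TriangleFree G)
  (n-odd : suc m ℕ.% 2 ≡ 1) (3≤n : 3 ℕ.≤ suc m)
  (σ : Fin (suc m) → Fin (suc m)) (σ-injective : Injective _≡_ _≡_ σ)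
  (cycle : ∀ p → G (σ p) (σ (CyclicDistance.next m p)) ≡ true)
  (bad : ∀ a b → DisjointCycleEdges {m} a b → NonCrossingEvenChord G σ a b ⊎ CrossingOddChord G σ a b) where

  open Parity
  open IntegerSums
  open EdgeEnumeration
  open NaturalWeights
  open GeneralPartition
  open LineGraphComplement G simple
  open import Data.Nat.Base using (s≤s⁻¹)
  import Data.Nat.Properties as ℕ
  open import Data.Integer.Base as ℤ using (+_)
  import Data.Integer.Properties as ℤ
  open import Data.Fin.Base as Fin using (zero)
  open import Data.Fin.Properties using () renaming (_≟_ to _≟ᶠ_)
  open import Data.Bool.Base using (if_then_else_; _∨_)
  open import Data.Bool.Properties using (not-injective)
  open import Data.List.Base using (foldr; tabulate)
  open import Data.Product.Base using (proj₁; proj₂)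
  open import Data.Empty using (⊥-elim)
  open import Relation.Nullary using (yes; no)
  open import Relation.Binary.PropositionalEquality
  open CyclicDistance m using (next)

  m-even : odd? m ≡ false
  m-even = not-injective (%2≡1⇒odd? (suc m) n-odd)

  2≤m : 2 ℕ.≤ m
  2≤m = s≤s⁻¹ 3≤n

  open CyclePositions G simple σ σ-injective cycle 2≤m
  open ChordWeights G simple σ σ-injective cycle 2≤m m-even

  star-σ : ∀ v k → star (σ v) k ≡ cycleStar v k
  star-σ v k = cong₂ _∨_ (same (endˡ G k)) (same (endʳ G k))
    where
    same : ∀ i → (i ==ᶠ σ v) ≡ (σ⁻¹ i ==ᶠ v)
    same i with i ≟ᶠ σ v | σ⁻¹ i ≟ᶠ v
    ... | yes _ | yes _ = refl
    ... | no _  | no _  = refl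
    ... | yes p | no q  = ⊥-elim (q (trans (cong σ⁻¹ p) (σ⁻¹-σ v)))
    ... | no p  | yes q = ⊥-elim (p (trans (sym (σ-σ⁻¹ i)) (cong σ q)))

  every-star-isMaximalStable : ∀ x → IsMaximalStable H (star x)
  every-star-isMaximalStable x = subst (λ y → IsMaximalStable H (star y)) (σ-σ⁻¹ x)
    (star-isMaximalStable triangle-free (σ v) (σ (next v)) (σ (prev v)) (cycle v) back distinct)
    where
    v = σ⁻¹ x
    back : G (σ v) (σ (prev v)) ≡ true
    back = trans (proj₁ simple (σ v) (σ (prev v))) (subst (λ u → G (σ (prev v)) (σ u) ≡ true) (next-prev v) (cycle (prev v)))
    distinct : σ (next v) ≢ σ (prev v)
    distinct e = next²≢ (prev v) (trans (cong next (next-prev v)) (σ-injective e))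
      where open CyclicDistance.Order≥3 m 2≤m using (next²≢)

  private
    +foldr≡∑ : ∀ {E E′} (S : Subset E′) (w : Fin E′ → ℕ) (f : Fin E → Fin E′) →
      + foldr (λ v acc → (if S v then w v else 0) ℕ.+ acc) 0 (tabulate f) ≡ ∑[ k < E ] when (S (f k)) (+ w (f k))
    +foldr≡∑ {zero}  S w f = refl
    +foldr≡∑ {suc E} S w f = trans (ℤ.pos-+ (if S (f zero) then w (f zero) else 0) _)
      (cong₂ ℤ._+_ (head (S (f zero))) (+foldr≡∑ S w (λ k → f (Fin.suc k))))
      where
      head : ∀ b → + (if b then w (f zero) else 0) ≡ when b (+ w (f zero))
      head true  = refl
      head false = refl

  edgeWeightℕ : Edge G → ℕ
  edgeWeightℕ k = suc (proj₁ (edgeWeight-positive k))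

  +weightℕ≡total : ∀ S → + weightℕ edgeWeightℕ S ≡ total S
  +weightℕ≡total S = trans (+foldr≡∑ S edgeWeightℕ (λ k → k)) (sum-cong-≗ (λ k → cong (when (S k)) (sym (proj₂ (edgeWeight-positive k)))))

  total-cong : ∀ {S S′} → (∀ k → S k ≡ S′ k) → total S ≡ total S′
  total-cong S≗S′ = sum-cong-≗ (λ k → cong (λ b → when b (edgeWeight k)) (S≗S′ k))

  maximalStable⇒total≡2D : ∀ S → IsMaximalStable H S → total S ≡ + 2 ℤ.* + D
  maximalStable⇒total≡2D S mx = trans (total-cong S≗) (total-star (prev v))
    where
    x = proj₁ (maximalStable⇒star triangle-free (edgeAt zero) S mx)
    v = σ⁻¹ x
    S≗ : ∀ k → S k ≡ cycleStar (next (prev v)) k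
    S≗ k = begin
      S k                          ≡⟨ proj₂ (maximalStable⇒star triangle-free (edgeAt zero) S mx) k ⟩
      star x k                     ≡⟨ cong (λ y → star y k) (σ-σ⁻¹ x) ⟨
      star (σ v) k                 ≡⟨ star-σ v k ⟩
      cycleStar v k                ≡⟨ cong (λ u → cycleStar u k) (next-prev v) ⟨
      cycleStar (next (prev v)) k  ∎
      where open ≡-Reasoning

  total≡2D⇒maximalStable : ∀ S → total S ≡ + 2 ℤ.* + D → IsMaximalStable H S
  total≡2D⇒maximalStable S e = from-star (total≡2D⇒star bad S e)
    where
    from-star : (Σ (Fin n) λ v → ∀ k → S k ≡ cycleStar v k) → IsMaximalStable H S
    from-star (v , S≗) = isMaximalStable-≗ (star (σ v)) S (λ k → trans (star-σ v k) (sym (S≗ k))) (every-star-isMaximalStable (σ v))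

  isEquistable : IsEquistable H
  isEquistable = equistable-byℕ H edgeWeightℕ (ℕ.pred (2 ℕ.* D)) (λ _ → ℕ.s≤s ℕ.z≤n) λ S →
    (λ mx → ℤ.+-injective (trans (+weightℕ≡total S) (trans (maximalStable⇒total≡2D S mx) +2D))) ,
    (λ w≡ → total≡2D⇒maximalStable S (trans (sym (+weightℕ≡total S)) (trans (cong +_ w≡) (sym +2D))))
    where
    +2D : + 2 ℤ.* + D ≡ + suc (ℕ.pred (2 ℕ.* D))
    +2D = trans (sym (ℤ.pos-* 2 D)) (cong +_ (sym (ℕ.suc-pred (2 ℕ.* D) {{ℕ.>-nonZero (ℕ.*-monoʳ-< 2 (ℕ.m^n>0 M E))}})))

  ¬strongClique : ¬ Σ (Subset _) (IsStrongClique H)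
  ¬strongClique = odd⇒¬strongClique (%2≡1⇒odd? (suc m) n-odd) every-star-isMaximalStable

  ¬generalPartition : ¬ IsGeneralPartition H
  ¬generalPartition gp = generalPartition⇒¬¬strongClique H (edgeAt zero) gp ¬strongClique

proposition8 : (n : ℕ) (G : Graph n) → IsSimple G → TriangleFree G → Bad G →
    IsEquistable (complement (lineGraph G))
    × (¬ Σ (Subset _) (IsStrongClique (complement (lineGraph G))))
    × (¬ IsGeneralPartition (complement (lineGraph G)))
proposition8 zero G _ _ ()
proposition8 (suc m) G simple triangle-free (n-odd , 3≤n , σ , σ-injective , cycle , bad) =
  isEquistable , ¬strongClique , ¬generalPartition
  where open BadGraph G simple triangle-free n-odd 3≤n σ σ-injective cycle bad
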